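{- Let $n \ge 1$ and define the linear operators $U$ and $D$ on the complex vector space $\mathbb{C}S_n$ with basis $S_n$ by \[ U(w) = \sum_{\substack{1 \le i \le n-1 \\ \ell(ws_i) = \ell(w)+1}} i \cdot ws_i, \qquad D(w) = \sum_{\substack{1 \le i < j \le n \\ \ell(wt_{ij}) = \ell(w)-1}} \Big(2\big(w_i - w_j - a(w,wt_{ij})\big) - 1\Big)\, wt_{ij}, \] where $a(w,wt_{ij}) = \#\{k < i : w_j < w_k < w_i\}$. Then for all $u, w \in S_n$ with $u \neq w$, the coefficient of $w$ in $(UD - DU)(u)$ is $0$.
   Context: $S_n$ is the symmetric group on $\{1,\ldots,n\}$, with permutations written in one-line notation $w = w_1 \cdots w_n$. For $1 \le i < j \le n$, $t_{ij}$ is the transposition $(i\ j)$, and $wt_{ij}$ is the permutation obtained from $w$ by swapping the entries in positions $i$ and $j$. We write $s_i = t_{i,i+1}$. The length $\ell(w)$ is the number of inversions of $w$, i.e. the number of pairs $p<q$ with $w_p>w_q$. -}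

module Defs where

open import Data.Nat as ℕ using (ℕ; zero; suc; _<?_; _≟_)
open import Data.Integer as ℤ using (ℤ; +_; _-_; _*_; -_)
open import Data.Fin using (Fin; toℕ)
open import Data.Vec using (Vec; lookup; _[_]≔_; toList)
open import Data.Vec.Properties using (≡-dec)
open import Data.List using (List; []; _∷_; map; concatMap; filter; length; upTo; allFin; _++_)
open import Data.List.Relation.Binary.Permutation.Propositional using (_↭_)
open import Data.Product using (_×_; _,_)
open import Relation.Nullary using (yes; no)
open import Relation.Nullary.Decidable using (_×-dec_)
open import Relation.Binary.PropositionalEquality using (_≡_)

-- A permutation of {1,…,n} in one-line notation: the word w₁⋯wₙ (positions
-- indexed by Fin n, position p corresponds to index toℕ p + 1).
IsPerm : ∀ {n} → Vec ℕ n → Set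
IsPerm {n} w = toList w ↭ map suc (upTo n)

pairs : (n : ℕ) → List (Fin n × Fin n)
pairs n = filter (λ { (p , q) → toℕ p <? toℕ q })
                 (concatMap (λ p → map (λ q → (p , q)) (allFin n)) (allFin n))

swap : ∀ {n} → Vec ℕ n → Fin n → Fin n → Vec ℕ n
swap w p q = (w [ p ]≔ lookup w q) [ q ]≔ lookup w p

len : ∀ {n} → Vec ℕ n → ℕ
len {n} w = length (filter (λ { (p , q) → lookup w q <? lookup w p }) (pairs n))

-- formal integer linear combinations of words (elements of ℤS_n ⊆ ℂS_n)
LC : ℕ → Set
LC n = List (ℤ × Vec ℕ n)

lin : ∀ {n} → (Vec ℕ n → LC n) → LC n → LC n
lin f = concatMap (λ { (c , v) → map (λ { (d , u) → (c * d , u) }) (f v) })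

-- U(w) = Σ_{ℓ(w s_i) = ℓ(w)+1} i · w s_i   (s_i swaps positions i, i+1; here
-- position p = i-1, q = i)
U : ∀ {n} → Vec ℕ n → LC n
U {n} w = map (λ { (p , q) → (+ suc (toℕ p) , swap w p q) })
  (filter (λ { (p , q) → (toℕ q ≟ suc (toℕ p)) ×-dec (len (swap w p q) ≟ suc (len w)) })
          (pairs n))

aCount : ∀ {n} → Vec ℕ n → Fin n → Fin n → ℕ
aCount {n} w i j = length (filter (λ k → (toℕ k <? toℕ i) ×-dec
                                        ((lookup w j <? lookup w k) ×-dec (lookup w k <? lookup w i)))
                                  (allFin n))

dCoeff : ∀ {n} → Vec ℕ n → Fin n → Fin n → ℤ
dCoeff w i j = + 2 * ((+ lookup w i - + lookup w j) - + aCount w i j) - + 1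

D : ∀ {n} → Vec ℕ n → LC n
D {n} w = map (λ { (i , j) → (dCoeff w i j , swap w i j) })
  (filter (λ { (i , j) → suc (len (swap w i j)) ≟ len w }) (pairs n))

comm : ∀ {n} → Vec ℕ n → LC n
comm u = lin U (D u) ++ map (λ { (c , v) → (- c , v) }) (lin D (U u))

coeff : ∀ {n} → Vec ℕ n → LC n → ℤ
coeff w [] = + 0
coeff w ((c , v) ∷ xs) with ≡-dec _≟_ v w
... | yes _ = c ℤ.+ coeff w xs
... | no _ = coeff w xs

module Submission where

-- Fix a pair of adjacent positions (p , q = p+1) and put s = t_pq.  Expanding both products,
-- the coefficient of w in UD(u) is a sum of terms  dCoeff u i j · (p+1)  over the chains
-- u ⋗ u t_ij ⋖ u t_ij s = w,  and that in DU(u) a sum of terms  (p+1) · dCoeff (u s) i' j'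
-- over the chains  u ⋖ u s ⋗ u s t_i'j' = w.  Since t_ij s = s t_(s i)(s j), reindexing the
-- second sum by (i' , j') = (s i , s j) matches the two sums term by term: the two chain
-- conditions are equivalent and the coefficients dCoeff agree.  The only pairs not covered are
-- {i , j} = {p , q}, which would force w = u.
--
-- Both the chain conditions and the coefficient comparison reduce to one length formula: for
-- distinct entries and i < j with u_j < u_i,
--   ℓ(u) = ℓ(u t_ij) + 1 + 2 · #{i < m < j : u_j < u_m < u_i},
-- so u t_ij ⋖ u exactly when no entry between positions i and j has a value between u_j and u_i,
-- and u ⋖ u s exactly when u_p < u_q.

open import Algebra.Bundles using (Semiring)
open import Data.Bool using (if_then_else_)
open import Data.Empty using (⊥; ⊥-elim)
open import Data.Fin as F using (Fin; toℕ)
open import Data.Fin.Permutation as Perm using ()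
import Data.Fin.Permutation.Components as PC
open import Data.Fin.Properties as FP using ()
open import Data.Integer as ℤ using (ℤ; +_)
open import Data.Integer.Properties as ZP using ()
open import Data.List using (List; []; _∷_; map; concatMap; filter; allFin; _++_; tabulate; length; upTo)
open import Data.List.Relation.Binary.Permutation.Propositional using (↭-sym; ↭⇒↭ₛ)
open import Data.List.Relation.Unary.Unique.Propositional using (Unique; _∷_)
open import Data.List.Relation.Unary.Unique.Propositional.Properties using (map⁺; upTo⁺)
open import Data.Nat as ℕ using (ℕ; zero; suc; _<?_; _≟_; _<_; _≤_; _<ᵇ_)
open import Data.Nat.Properties as NP using (<ᵇ-reflects-<)
open import Data.Nat.Tactic.RingSolver using (solve-∀)
open import Data.Product using (_×_; _,_; proj₁; proj₂)
open import Data.Sum using (_⊎_; inj₁; inj₂)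
open import Data.Vec using (Vec; []; _∷_; lookup; _[_]≔_; toList)
open import Data.Vec.Properties as VP using (≡-dec)
open import Data.Vec.Relation.Binary.Pointwise.Extensional using (ext; Pointwise-≡⇒≡)
open import Data.Vec.Relation.Unary.All.Properties as VAll using ()
open import Function using (_∘_)
open import Function.Definitions using (Injective)
open import Level using (0ℓ)
open import Relation.Binary.Definitions using (tri<; tri≈; tri>)
open import Relation.Binary.PropositionalEquality
open import Data.List.Relation.Binary.Permutation.Setoid.Properties (setoid ℕ) using (Unique-resp-↭)
open import Relation.Nullary using (Dec; yes; no; does; ¬_)
open import Relation.Nullary.Decidable using (_×-dec_)
open import Relation.Nullary.Reflects using (Reflects; ofʸ; ofⁿ; fromEquivalence)
open import Defs

module Sums (R : Semiring 0ℓ 0ℓ) where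
  open Semiring R renaming (refl to ≈-refl; sym to ≈-sym; trans to ≈-trans)
  open import Algebra.Properties.Semiring.Sum R public
  open import Relation.Binary.Reasoning.Setoid (Semiring.setoid R)

  when : ∀ {p} {P : Set p} → Dec P → Carrier → Carrier
  when d x = if does d then x else 0#

  sumOver : ∀ {X : Set} → List X → (X → Carrier) → Carrier
  sumOver [] h = 0#
  sumOver (x ∷ xs) h = h x + sumOver xs h

  sumOver-cong : ∀ {X : Set} (xs : List X) {h g : X → Carrier} → (∀ x → h x ≈ g x) →
    sumOver xs h ≈ sumOver xs g
  sumOver-cong [] e = ≈-refl
  sumOver-cong (x ∷ xs) e = +-cong (e x) (sumOver-cong xs e)

  sumOver-++ : ∀ {X : Set} (xs ys : List X) h → sumOver (xs ++ ys) h ≈ sumOver xs h + sumOver ys h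
  sumOver-++ [] ys h = ≈-sym (+-identityˡ _)
  sumOver-++ (x ∷ xs) ys h = ≈-trans (+-congˡ (sumOver-++ xs ys h)) (≈-sym (+-assoc _ _ _))

  sumOver-map : ∀ {X Y : Set} (f : X → Y) (xs : List X) h → sumOver (map f xs) h ≈ sumOver xs (h ∘ f)
  sumOver-map f [] h = ≈-refl
  sumOver-map f (x ∷ xs) h = +-congˡ (sumOver-map f xs h)

  sumOver-concatMap : ∀ {X Y : Set} (f : X → List Y) (xs : List X) h →
    sumOver (concatMap f xs) h ≈ sumOver xs (λ x → sumOver (f x) h)
  sumOver-concatMap f [] h = ≈-refl
  sumOver-concatMap f (x ∷ xs) h =
    ≈-trans (sumOver-++ (f x) (concatMap f xs) h) (+-congˡ (sumOver-concatMap f xs h))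

  sumOver-filter : ∀ {X : Set} {P : X → Set} (P? : ∀ x → Dec (P x)) (xs : List X) h →
    sumOver (filter P? xs) h ≈ sumOver xs (λ x → when (P? x) (h x))
  sumOver-filter P? [] h = ≈-refl
  sumOver-filter P? (x ∷ xs) h with P? x
  ... | yes _ = +-congˡ (sumOver-filter P? xs h)
  ... | no _ = ≈-trans (sumOver-filter P? xs h) (≈-sym (+-identityˡ _))

  sumOver-tabulate : ∀ {X : Set} n (f : Fin n → X) (h : X → Carrier) →
    sumOver (tabulate f) h ≈ sum (h ∘ f)
  sumOver-tabulate zero f h = ≈-refl
  sumOver-tabulate (suc n) f h = +-congˡ (sumOver-tabulate n (f ∘ F.suc) h)

  sumOver-allFin : ∀ n (h : Fin n → Carrier) → sumOver (allFin n) h ≈ sum h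
  sumOver-allFin n h = sumOver-tabulate n (λ x → x) h

  sumOver-pairs : ∀ n (h : Fin n × Fin n → Carrier) →
    sumOver (pairs n) h ≈ sum (λ i → sum (λ j → when (toℕ i <? toℕ j) (h (i , j))))
  sumOver-pairs n h = begin
    sumOver (pairs n) h
      ≈⟨ sumOver-filter _ (concatMap (λ p → map (λ q → (p , q)) (allFin n)) (allFin n)) h ⟩
    sumOver (concatMap (λ p → map (λ q → (p , q)) (allFin n)) (allFin n)) _
      ≈⟨ sumOver-concatMap _ (allFin n) _ ⟩
    sumOver (allFin n) (λ i → sumOver (map (λ q → (i , q)) (allFin n)) _)
      ≈⟨ sumOver-cong (allFin n) (λ i → ≈-trans (sumOver-map _ (allFin n) _) (sumOver-allFin n _)) ⟩
    sumOver (allFin n) (λ i → sum (λ j → when (toℕ i <? toℕ j) (h (i , j))))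
      ≈⟨ sumOver-allFin n _ ⟩
    _ ∎

  when-no : ∀ {p} {P : Set p} (d : Dec P) → ¬ P → ∀ x → when d x ≈ 0#
  when-no (yes holds) ¬holds x = ⊥-elim (¬holds holds)
  when-no (no _) _ x = ≈-refl

  when-yes : ∀ {p} {P : Set p} (d : Dec P) → P → ∀ x → when d x ≈ x
  when-yes (yes _) _ x = ≈-refl
  when-yes (no ¬holds) holds x = ⊥-elim (¬holds holds)

  when-zero : ∀ {p} {P : Set p} (d : Dec P) → when d 0# ≈ 0#
  when-zero (yes _) = ≈-refl
  when-zero (no _) = ≈-refl

  when-when : ∀ {p q} {P : Set p} {Q : Set q} (d : Dec P) (e : Dec Q) x → when d (when e x) ≈ when (d ×-dec e) x
  when-when (yes _) (yes _) x = ≈-refl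
  when-when (yes _) (no _) x = ≈-refl
  when-when (no _) _ x = ≈-refl

  when-⇔ : ∀ {p q} {P : Set p} {Q : Set q} (d : Dec P) (e : Dec Q) {x y} →
    (P → Q) → (Q → P) → (P → x ≈ y) → when d x ≈ when e y
  when-⇔ (yes holds) (yes _) _ _ x≈y = x≈y holds
  when-⇔ (yes holds) (no ¬holds′) P⇒Q _ _ = ⊥-elim (¬holds′ (P⇒Q holds))
  when-⇔ (no ¬holds) (yes holds′) _ Q⇒P _ = ⊥-elim (¬holds (Q⇒P holds′))
  when-⇔ (no _) (no _) _ _ _ = ≈-refl

  when-*ˡ : ∀ {p} {P : Set p} (d : Dec P) c x → when d (c * x) ≈ c * when d x
  when-*ˡ (yes _) c x = ≈-refl
  when-*ˡ (no _) c x = ≈-sym (zeroʳ c)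

  when-sum : ∀ {p} {P : Set p} (d : Dec P) {n} (f : Fin n → Carrier) → when d (sum f) ≈ sum (λ i → when d (f i))
  when-sum (yes _) f = ≈-refl
  when-sum (no _) {n} f = ≈-sym (sum-replicate-zero n)

  sumOver-*ˡ : ∀ {X : Set} c (xs : List X) (h : X → Carrier) → sumOver xs (λ x → c * h x) ≈ c * sumOver xs h
  sumOver-*ˡ c [] h = ≈-sym (zeroʳ c)
  sumOver-*ˡ c (x ∷ xs) h = ≈-trans (+-congˡ (sumOver-*ˡ c xs h)) (≈-sym (distribˡ c (h x) (sumOver xs h)))

  sum-transpose : ∀ {n} (i j : Fin n) (f : Fin n → Carrier) → sum f ≈ sum (f ∘ PC.transpose i j)
  sum-transpose i j f = ∑-permute f (Perm.transpose i j)

-- Transpositions of positions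

_!_ : ∀ {n} → Vec ℕ n → Fin n → ℕ
u ! m = lookup u m

Distinct : ∀ {n} → Vec ℕ n → Set
Distinct u = Injective _≡_ _≡_ (u !_)

τ : ∀ {n} → Fin n → Fin n → Fin n → Fin n
τ = PC.transpose

data TransposeCase {n} (i j k : Fin n) (t : Fin n) : Set where
  at-i : k ≡ i → t ≡ j → TransposeCase i j k t
  at-j : k ≢ i → k ≡ j → t ≡ i → TransposeCase i j k t
  away : k ≢ i → k ≢ j → t ≡ k → TransposeCase i j k t

transpose-case : ∀ {n} (i j k : Fin n) → TransposeCase i j k (τ i j k)
transpose-case i j k with k FP.≟ i
... | yes k≡i = at-i k≡i refl
... | no k≢i with k FP.≟ j
...   | yes k≡j = at-j k≢i k≡j refl
...   | no k≢j = away k≢i k≢j refl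

τ-i : ∀ {n} (i j : Fin n) → τ i j i ≡ j
τ-i i j with transpose-case i j i
... | at-i _ e = e
... | at-j i≢i _ _ = ⊥-elim (i≢i refl)
... | away i≢i _ _ = ⊥-elim (i≢i refl)

τ-j : ∀ {n} (i j : Fin n) → τ i j j ≡ i
τ-j i j with transpose-case i j j
... | at-i j≡i e = trans e j≡i
... | at-j _ _ e = e
... | away _ j≢j _ = ⊥-elim (j≢j refl)

τ-away : ∀ {n} {i j k : Fin n} → k ≢ i → k ≢ j → τ i j k ≡ k
τ-away {i = i} {j} {k} k≢i k≢j with transpose-case i j k
... | at-i k≡i _ = ⊥-elim (k≢i k≡i)
... | at-j _ k≡j _ = ⊥-elim (k≢j k≡j)
... | away _ _ e = e

τ-involutive : ∀ {n} (i j k : Fin n) → τ i j (τ i j k) ≡ k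
τ-involutive i j k with transpose-case i j k
... | at-i refl e = trans (cong (τ i j) e) (τ-j i j)
... | at-j _ refl e = trans (cong (τ i j) e) (τ-i i j)
... | away _ _ e = trans (cong (τ i j) e) e

τ-injective : ∀ {n} (i j : Fin n) → Injective _≡_ _≡_ (τ i j)
τ-injective i j {x} {y} e = trans (sym (τ-involutive i j x)) (trans (cong (τ i j) e) (τ-involutive i j y))

τ-sym : ∀ {n} (i j k : Fin n) → τ j i k ≡ τ i j k
τ-sym i j k with transpose-case i j k
... | at-i refl e = trans (τ-j j k) (sym e)
... | at-j _ refl e = trans (τ-i k i) (sym e)
... | away k≢i k≢j e = trans (τ-away k≢j k≢i) (sym e)

τ-conjugate : ∀ {n} (f : Fin n → Fin n) → Injective _≡_ _≡_ f →
  ∀ i j k → τ (f i) (f j) (f k) ≡ f (τ i j k)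
τ-conjugate f f-inj i j k with transpose-case i j k
... | at-i refl e = trans (τ-i (f k) (f j)) (sym (cong f e))
... | at-j _ refl e = trans (τ-j (f i) (f k)) (sym (cong f e))
... | away k≢i k≢j e = trans (τ-away (k≢i ∘ f-inj) (k≢j ∘ f-inj)) (sym (cong f e))

lookup-swap : ∀ {n} (u : Vec ℕ n) (i j k : Fin n) → swap u i j ! k ≡ u ! τ i j k
lookup-swap u i j k with transpose-case i j k
... | at-i refl e rewrite e with k FP.≟ j
...   | yes refl = VP.lookup∘update k (u [ k ]≔ lookup u k) (lookup u k)
...   | no k≢j = trans (VP.lookup∘update′ k≢j (u [ k ]≔ lookup u j) (lookup u k))
                       (VP.lookup∘update k u (lookup u j))
lookup-swap u i j k | at-j _ refl e rewrite e = VP.lookup∘update k (u [ i ]≔ lookup u k) (lookup u i)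
lookup-swap u i j k | away k≢i k≢j e rewrite e =
  trans (VP.lookup∘update′ k≢j (u [ i ]≔ lookup u j) (lookup u i)) (VP.lookup∘update′ k≢i u (lookup u j))

lookup-swap-i : ∀ {n} (u : Vec ℕ n) (i j : Fin n) → swap u i j ! i ≡ u ! j
lookup-swap-i u i j = trans (lookup-swap u i j i) (cong (u !_) (τ-i i j))

lookup-swap-j : ∀ {n} (u : Vec ℕ n) (i j : Fin n) → swap u i j ! j ≡ u ! i
lookup-swap-j u i j = trans (lookup-swap u i j j) (cong (u !_) (τ-j i j))

lookup-swap-away : ∀ {n} (u : Vec ℕ n) {i j k : Fin n} → k ≢ i → k ≢ j → swap u i j ! k ≡ u ! k
lookup-swap-away u {i} {j} k≢i k≢j = trans (lookup-swap u i j _) (cong (u !_) (τ-away k≢i k≢j))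

lookup-swap-swap : ∀ {n} (u : Vec ℕ n) (i j k : Fin n) → swap (swap u i j) i j ! k ≡ u ! k
lookup-swap-swap u i j k =
  trans (lookup-swap (swap u i j) i j k) (trans (lookup-swap u i j (τ i j k)) (cong (u !_) (τ-involutive i j k)))

swap-distinct : ∀ {n} (u : Vec ℕ n) (i j : Fin n) → Distinct u → Distinct (swap u i j)
swap-distinct u i j u-distinct {k} {l} e =
  τ-injective i j (u-distinct (trans (sym (lookup-swap u i j k)) (trans e (lookup-swap u i j l))))

vec-ext : ∀ {n} (xs ys : Vec ℕ n) → (∀ k → xs ! k ≡ ys ! k) → xs ≡ ys
vec-ext xs ys e = Pointwise-≡⇒≡ (ext e)

-- Opened only here, so that inside Sums the names _+_ and _*_ refer to the semiring.
open import Data.Nat using (_+_; _*_)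

module ℕSum = Sums NP.+-*-semiring
open ℕSum using () renaming (sum to ∑)

𝟙 : ∀ {p} {P : Set p} → Dec P → ℕ
𝟙 d = ℕSum.when d 1

𝟙-yes : ∀ {p} {P : Set p} (d : Dec P) → P → 𝟙 d ≡ 1
𝟙-yes d holds = ℕSum.when-yes d holds 1

𝟙-no : ∀ {p} {P : Set p} (d : Dec P) → ¬ P → 𝟙 d ≡ 0
𝟙-no d ¬holds = ℕSum.when-no d ¬holds 1

𝟙≡0⇒¬ : ∀ {p} {P : Set p} (d : Dec P) → 𝟙 d ≡ 0 → ¬ P
𝟙≡0⇒¬ (no ¬p) _ = ¬p

𝟙-×-dec : ∀ {a b} {A : Set a} {B : Set b} (d : Dec A) (e : Dec B) → 𝟙 (d ×-dec e) ≡ 𝟙 d * 𝟙 e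
𝟙-×-dec (yes _) (yes _) = refl
𝟙-×-dec (yes _) (no _) = refl
𝟙-×-dec (no _) _ = refl

when-𝟙 : ∀ {p} {P : Set p} (d : Dec P) x → ℕSum.when d x ≡ 𝟙 d * x
when-𝟙 (yes _) x = sym (NP.+-identityʳ x)
when-𝟙 (no _) x = refl

length-filter : ∀ {X : Set} {P : X → Set} (P? : ∀ x → Dec (P x)) (xs : List X) →
  length (filter P? xs) ≡ ℕSum.sumOver xs (λ x → 𝟙 (P? x))
length-filter P? [] = refl
length-filter P? (x ∷ xs) with P? x
... | yes _ = cong suc (length-filter P? xs)
... | no _ = length-filter P? xs

∑-zero : ∀ n → ∑ {n} (λ _ → 0) ≡ 0
∑-zero n = ℕSum.sum-replicate-zero n

∑-cong : ∀ {n} {f g : Fin n → ℕ} → (∀ k → f k ≡ g k) → ∑ f ≡ ∑ g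
∑-cong = ℕSum.sum-cong-≗

∑-+ : ∀ {n} (f g : Fin n → ℕ) → ∑ (λ k → f k + g k) ≡ ∑ f + ∑ g
∑-+ = ℕSum.∑-distrib-+

∑-δ : ∀ {n} (i : Fin n) (f : Fin n → ℕ) → ∑ (λ k → 𝟙 (k FP.≟ i) * f k) ≡ f i
∑-δ {suc n} F.zero f =
  trans (cong (λ z → f F.zero + 0 + z) (∑-zero n)) (trans (NP.+-identityʳ _) (NP.+-identityʳ _))
∑-δ {suc n} (F.suc i) f = ∑-δ i (f ∘ F.suc)

∑-τ : ∀ {n} (i j : Fin n) (f : Fin n → ℕ) → ∑ f ≡ ∑ (f ∘ τ i j)
∑-τ = ℕSum.sum-transpose

≮∧≯⇒≡ : ∀ {m n : ℕ} → ¬ m < n → ¬ n < m → m ≡ n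
≮∧≯⇒≡ m≮n n≮m = NP.≤-antisym (NP.≮⇒≥ n≮m) (NP.≮⇒≥ m≮n)

≮∧≢⇒> : ∀ {m n : ℕ} → ¬ m < n → m ≢ n → n < m
≮∧≢⇒> m≮n m≢n = NP.≤∧≢⇒< (NP.≮⇒≥ m≮n) (m≢n ∘ sym)

≮-<-≮ : ∀ {m n k : ℕ} → ¬ m < n → m < k → ¬ n < k → ⊥
≮-<-≮ m≮n m<k n≮k = n≮k (NP.≤-<-trans (NP.≮⇒≥ m≮n) m<k)

≡ᵇ-reflects-≡ : ∀ m n → Reflects (m ≡ n) (m ℕ.≡ᵇ n)
≡ᵇ-reflects-≡ m n = fromEquivalence (NP.≡ᵇ⇒≡ m n) (NP.≡⇒≡ᵇ m n)

-- Entries 𝟙[x < y] · 𝟙[u_y < u_x] of the inversion matrices of u and of u t_ij, where a = u_i > b = u_j: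
-- at (p , i) and (p , j) for a row p ∉ {i , j} with c = u_p, and at (i , q) and (j , q) for a column q
-- with c = u_q.  The discrepancy is 𝟙[i < p < j] · 𝟙[b < c < a].  Since m <? n computes through m <ᵇ n,
-- the case splits abstract that boolean together with its reflection.

inversions-row : ∀ p i j a b c → i < j → b < a → c ≢ a → c ≢ b → p ≢ i → p ≢ j →
  𝟙 (p <? i) * 𝟙 (a <? c) + 𝟙 (p <? j) * 𝟙 (b <? c) ≡
  (𝟙 (p <? j) * 𝟙 (a <? c) + 𝟙 (p <? i) * 𝟙 (b <? c)) + 𝟙 (i <? p) * 𝟙 (p <? j) * 𝟙 (b <? c) * 𝟙 (c <? a)
inversions-row p i j a b c i<j b<a c≢a c≢b p≢i p≢j
  with p <ᵇ i | <ᵇ-reflects-< p i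
     | p <ᵇ j | <ᵇ-reflects-< p j
     | i <ᵇ p | <ᵇ-reflects-< i p
     | b <ᵇ c | <ᵇ-reflects-< b c
     | c <ᵇ a | <ᵇ-reflects-< c a
     | a <ᵇ c | <ᵇ-reflects-< a c
... | _ | ofʸ x | _ | ofⁿ y | _ | _ | _ | _ | _ | _ | _ | _ = ⊥-elim (y (NP.<-trans x i<j))
... | _ | ofʸ x | _ | _ | _ | ofʸ y | _ | _ | _ | _ | _ | _ = ⊥-elim (NP.<-asym x y)
... | _ | ofⁿ x | _ | _ | _ | ofⁿ y | _ | _ | _ | _ | _ | _ = ⊥-elim (p≢i (≮∧≯⇒≡ x y))
... | _ | _ | _ | _ | _ | _ | _ | ofⁿ x | _ | ofⁿ y | _ | _ = ⊥-elim (≮-<-≮ x b<a y)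
... | _ | _ | _ | _ | _ | _ | _ | _ | _ | ofʸ x | _ | ofʸ y = ⊥-elim (NP.<-asym x y)
... | _ | _ | _ | _ | _ | _ | _ | ofʸ _ | _ | ofⁿ x | _ | ofⁿ y = ⊥-elim (c≢a (≮∧≯⇒≡ x y))
... | _ | ofʸ _ | _ | ofʸ _ | _ | ofⁿ _ | _ | ofⁿ _ | _ | ofʸ _ | _ | ofⁿ _ = refl
... | _ | ofʸ _ | _ | ofʸ _ | _ | ofⁿ _ | _ | ofʸ _ | _ | ofʸ _ | _ | ofⁿ _ = refl
... | _ | ofʸ _ | _ | ofʸ _ | _ | ofⁿ _ | _ | ofʸ _ | _ | ofⁿ _ | _ | ofʸ _ = refl
... | _ | ofⁿ _ | _ | ofʸ _ | _ | ofʸ _ | _ | ofⁿ _ | _ | ofʸ _ | _ | ofⁿ _ = refl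
... | _ | ofⁿ _ | _ | ofʸ _ | _ | ofʸ _ | _ | ofʸ _ | _ | ofʸ _ | _ | ofⁿ _ = refl
... | _ | ofⁿ _ | _ | ofʸ _ | _ | ofʸ _ | _ | ofʸ _ | _ | ofⁿ _ | _ | ofʸ _ = refl
... | _ | ofⁿ _ | _ | ofⁿ _ | _ | ofʸ _ | _ | ofⁿ _ | _ | ofʸ _ | _ | ofⁿ _ = refl
... | _ | ofⁿ _ | _ | ofⁿ _ | _ | ofʸ _ | _ | ofʸ _ | _ | ofʸ _ | _ | ofⁿ _ = refl
... | _ | ofⁿ _ | _ | ofⁿ _ | _ | ofʸ _ | _ | ofʸ _ | _ | ofⁿ _ | _ | ofʸ _ = refl

inversions-column : ∀ q i j a b c → i < j → b < a → c ≢ a → c ≢ b → q ≢ i → q ≢ j →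
  𝟙 (i <? q) * 𝟙 (c <? a) + 𝟙 (j <? q) * 𝟙 (c <? b) ≡
  (𝟙 (j <? q) * 𝟙 (c <? a) + 𝟙 (i <? q) * 𝟙 (c <? b)) + 𝟙 (i <? q) * 𝟙 (q <? j) * 𝟙 (b <? c) * 𝟙 (c <? a)
inversions-column q i j a b c i<j b<a c≢a c≢b q≢i q≢j
  with i <ᵇ q | <ᵇ-reflects-< i q
     | j <ᵇ q | <ᵇ-reflects-< j q
     | q <ᵇ j | <ᵇ-reflects-< q j
     | c <ᵇ a | <ᵇ-reflects-< c a
     | c <ᵇ b | <ᵇ-reflects-< c b
     | b <ᵇ c | <ᵇ-reflects-< b c
... | _ | ofⁿ x | _ | ofʸ y | _ | _ | _ | _ | _ | _ | _ | _ = ⊥-elim (x (NP.<-trans i<j y))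
... | _ | _ | _ | ofʸ x | _ | ofʸ y | _ | _ | _ | _ | _ | _ = ⊥-elim (NP.<-asym x y)
... | _ | _ | _ | ofⁿ x | _ | ofⁿ y | _ | _ | _ | _ | _ | _ = ⊥-elim (q≢j (≮∧≯⇒≡ y x))
... | _ | ofⁿ x | _ | ofⁿ _ | _ | ofʸ _ | _ | _ | _ | _ | _ | _ = refl
... | _ | _ | _ | _ | _ | _ | _ | ofⁿ x | _ | _ | _ | ofⁿ y = ⊥-elim (≮-<-≮ y b<a x)
... | _ | _ | _ | _ | _ | _ | _ | _ | _ | ofʸ x | _ | ofʸ y = ⊥-elim (NP.<-asym x y)
... | _ | _ | _ | _ | _ | _ | _ | _ | _ | ofⁿ x | _ | ofⁿ y = ⊥-elim (c≢b (≮∧≯⇒≡ x y))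
... | _ | ofʸ _ | _ | ofⁿ _ | _ | ofʸ _ | _ | ofʸ _ | _ | ofʸ _ | _ | ofⁿ _ = refl
... | _ | ofʸ _ | _ | ofⁿ _ | _ | ofʸ _ | _ | ofʸ _ | _ | ofⁿ _ | _ | ofʸ _ = refl
... | _ | ofʸ _ | _ | ofⁿ _ | _ | ofʸ _ | _ | ofⁿ _ | _ | ofⁿ _ | _ | ofʸ _ = refl
... | _ | ofʸ _ | _ | ofʸ _ | _ | ofⁿ _ | _ | ofʸ _ | _ | ofʸ _ | _ | ofⁿ _ = refl
... | _ | ofʸ _ | _ | ofʸ _ | _ | ofⁿ _ | _ | ofʸ _ | _ | ofⁿ _ | _ | ofʸ _ = refl
... | _ | ofʸ _ | _ | ofʸ _ | _ | ofⁿ _ | _ | ofⁿ _ | _ | ofⁿ _ | _ | ofʸ _ = refl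

inversions-column-i : ∀ i j a b → i < j → b < a →
  𝟙 (i <? i) * 𝟙 (a <? a) + 𝟙 (j <? i) * 𝟙 (a <? b) ≡
  (𝟙 (j <? j) * 𝟙 (a <? a) + 𝟙 (i <? j) * 𝟙 (a <? b)) + 𝟙 (i <? i) * 𝟙 (i <? j) * 𝟙 (b <? a) * 𝟙 (a <? a)
inversions-column-i i j a b i<j b<a with i <ᵇ i | <ᵇ-reflects-< i i
                                       | j <ᵇ i | <ᵇ-reflects-< j i
                                       | j <ᵇ j | <ᵇ-reflects-< j j
                                       | i <ᵇ j | <ᵇ-reflects-< i j
                                       | a <ᵇ b | <ᵇ-reflects-< a b
... | _ | ofʸ x | _ | _ | _ | _ | _ | _ | _ | _ = ⊥-elim (NP.<-irrefl refl x)
... | _ | _ | _ | ofʸ x | _ | _ | _ | _ | _ | _ = ⊥-elim (NP.<-asym x i<j)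
... | _ | _ | _ | _ | _ | ofʸ x | _ | _ | _ | _ = ⊥-elim (NP.<-irrefl refl x)
... | _ | _ | _ | _ | _ | _ | _ | _ | _ | ofʸ x = ⊥-elim (NP.<-asym x b<a)
... | _ | _ | _ | _ | _ | _ | _ | ofⁿ x | _ | _ = ⊥-elim (x i<j)
... | _ | ofⁿ _ | _ | ofⁿ _ | _ | ofⁿ _ | _ | ofʸ _ | _ | ofⁿ _ = refl

inversions-column-j : ∀ i j a b → i < j → b < a →
  𝟙 (i <? j) * 𝟙 (b <? a) + 𝟙 (j <? j) * 𝟙 (b <? b) ≡
  (𝟙 (j <? i) * 𝟙 (b <? a) + 𝟙 (i <? i) * 𝟙 (b <? b)) + (1 + 𝟙 (i <? j) * 𝟙 (j <? j) * 𝟙 (b <? b) * 𝟙 (b <? a))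
inversions-column-j i j a b i<j b<a with i <ᵇ i | <ᵇ-reflects-< i i
                                       | j <ᵇ i | <ᵇ-reflects-< j i
                                       | j <ᵇ j | <ᵇ-reflects-< j j
                                       | i <ᵇ j | <ᵇ-reflects-< i j
                                       | b <ᵇ a | <ᵇ-reflects-< b a
... | _ | ofʸ x | _ | _ | _ | _ | _ | _ | _ | _ = ⊥-elim (NP.<-irrefl refl x)
... | _ | _ | _ | ofʸ x | _ | _ | _ | _ | _ | _ = ⊥-elim (NP.<-asym x i<j)
... | _ | _ | _ | _ | _ | ofʸ x | _ | _ | _ | _ = ⊥-elim (NP.<-irrefl refl x)
... | _ | _ | _ | _ | _ | _ | _ | ofⁿ x | _ | _ = ⊥-elim (x i<j)
... | _ | _ | _ | _ | _ | _ | _ | _ | _ | ofⁿ x = ⊥-elim (x b<a)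
... | _ | ofⁿ _ | _ | ofⁿ _ | _ | ofⁿ _ | _ | ofʸ _ | _ | ofʸ _ = refl

inside : ℕ → ℕ → ℕ → ℕ
inside a b m = 𝟙 (a <? m) * 𝟙 (m <? b)

inside-≤ : ∀ {a b m} → m ≤ a → inside a b m ≡ 0
inside-≤ {a} {b} {m} m≤a = cong (_* 𝟙 (m <? b)) (𝟙-no (a <? m) (NP.≤⇒≯ m≤a))

inside-≥ : ∀ {a b m} → b ≤ m → inside a b m ≡ 0
inside-≥ {a} {b} {m} b≤m = trans (cong (𝟙 (a <? m) *_) (𝟙-no (m <? b) (NP.≤⇒≯ b≤m))) (NP.*-zeroʳ (𝟙 (a <? m)))

inside-suc : ∀ a m → inside a (suc a) m ≡ 0
inside-suc a m with a <ᵇ m | <ᵇ-reflects-< a m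
... | _ | ofʸ a<m = trans (NP.*-identityˡ _) (𝟙-no (m <? suc a) (NP.≤⇒≯ a<m))
... | _ | ofⁿ _ = refl

𝟙-≟-toℕ : ∀ {n} (m k : Fin n) → 𝟙 (m FP.≟ k) ≡ 𝟙 (toℕ m ≟ toℕ k)
𝟙-≟-toℕ m k with m FP.≟ k | toℕ m ℕ.≡ᵇ toℕ k | ≡ᵇ-reflects-≡ (toℕ m) (toℕ k)
... | yes _ | _ | ofʸ _ = refl
... | yes m≡k | _ | ofⁿ m≢k = ⊥-elim (m≢k (cong toℕ m≡k))
... | no m≢k | _ | ofʸ m≡k = ⊥-elim (m≢k (FP.toℕ-injective m≡k))
... | no _ | _ | ofⁿ _ = refl

𝟙<suc : ∀ p m → 𝟙 (m <? suc p) ≡ 𝟙 (m <? p) + 𝟙 (m ≟ p)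
𝟙<suc p m with m <ᵇ suc p | <ᵇ-reflects-< m (suc p) | m <ᵇ p | <ᵇ-reflects-< m p
                 | m ℕ.≡ᵇ p | ≡ᵇ-reflects-≡ m p
... | _ | ofⁿ x | _ | ofʸ y | _ | _ = ⊥-elim (x (NP.<-trans y (NP.n<1+n p)))
... | _ | ofⁿ x | _ | _ | _ | ofʸ e = ⊥-elim (x (subst (_< suc p) (sym e) (NP.n<1+n p)))
... | _ | ofʸ x | _ | ofⁿ y | _ | ofⁿ e = ⊥-elim (e (NP.≤-antisym (NP.≤-pred x) (NP.≮⇒≥ y)))
... | _ | _ | _ | ofʸ y | _ | ofʸ e = ⊥-elim (NP.<-irrefl e y)
... | _ | ofʸ _ | _ | ofʸ _ | _ | ofⁿ _ = refl
... | _ | ofʸ _ | _ | ofⁿ _ | _ | ofʸ _ = refl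
... | _ | ofⁿ _ | _ | ofⁿ _ | _ | ofⁿ _ = refl

inside-suc-left : ∀ p j m → suc p < j → inside p j m ≡ 𝟙 (m ≟ suc p) + inside (suc p) j m
inside-suc-left p j m q<j
  with p <ᵇ m | <ᵇ-reflects-< p m | m <ᵇ j | <ᵇ-reflects-< m j
     | m ℕ.≡ᵇ suc p | ≡ᵇ-reflects-≡ m (suc p) | suc p <ᵇ m | <ᵇ-reflects-< (suc p) m
... | _ | ofⁿ x | _ | _ | _ | ofʸ e | _ | _ = ⊥-elim (x (subst (p <_) (sym e) (NP.n<1+n p)))
... | _ | ofⁿ x | _ | _ | _ | _ | _ | ofʸ y = ⊥-elim (x (NP.<-trans (NP.n<1+n p) y))
... | _ | ofⁿ _ | _ | _ | _ | ofⁿ _ | _ | ofⁿ _ = refl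
... | _ | ofʸ x | _ | _ | _ | ofⁿ e | _ | ofⁿ y = ⊥-elim (e (NP.≤-antisym (NP.≮⇒≥ y) x))
... | _ | ofʸ _ | _ | _ | _ | ofʸ e | _ | ofʸ y = ⊥-elim (NP.<-irrefl (sym e) y)
... | _ | ofʸ _ | _ | ofⁿ z | _ | ofʸ e | _ | ofⁿ _ = ⊥-elim (z (subst (_< j) (sym e) q<j))
... | _ | ofʸ _ | _ | ofʸ _ | _ | ofʸ _ | _ | ofⁿ _ = refl
... | _ | ofʸ _ | _ | _ | _ | ofⁿ _ | _ | ofʸ _ = refl

inside-suc-right : ∀ i p m → i < p → inside i (suc p) m ≡ inside i p m + 𝟙 (m ≟ p)
inside-suc-right i p m i<p with i <ᵇ m | <ᵇ-reflects-< i m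
... | _ | ofʸ _ = trans (NP.+-identityʳ (𝟙 (m <? suc p)))
                    (trans (𝟙<suc p m) (cong (_+ 𝟙 (m ≟ p)) (sym (NP.+-identityʳ (𝟙 (m <? p))))))
... | _ | ofⁿ i≮m with m ℕ.≡ᵇ p | ≡ᵇ-reflects-≡ m p
...   | _ | ofʸ e = ⊥-elim (i≮m (subst (i <_) (sym e) i<p))
...   | _ | ofⁿ _ = refl

𝟙-suc-< : ∀ i p → i ≢ p → i ≢ suc p → 𝟙 (p <? i) ≡ 𝟙 (suc p <? i)
𝟙-suc-< i p i≢p i≢q with p <ᵇ i | <ᵇ-reflects-< p i | suc p <ᵇ i | <ᵇ-reflects-< (suc p) i
... | _ | ofⁿ x | _ | ofʸ y = ⊥-elim (x (NP.<-trans (NP.n<1+n p) y))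
... | _ | ofʸ x | _ | ofⁿ y = ⊥-elim (i≢q (NP.≤-antisym (NP.≮⇒≥ y) x))
... | _ | ofʸ _ | _ | ofʸ _ = refl
... | _ | ofⁿ _ | _ | ofⁿ _ = refl

inside-at-suc : ∀ i j p → i ≢ p → i ≢ suc p → j ≢ p → j ≢ suc p → inside i j p ≡ inside i j (suc p)
inside-at-suc i j p i≢p i≢q j≢p j≢q
  with i <ᵇ p | <ᵇ-reflects-< i p | i <ᵇ suc p | <ᵇ-reflects-< i (suc p)
     | p <ᵇ j | <ᵇ-reflects-< p j | suc p <ᵇ j | <ᵇ-reflects-< (suc p) j
... | _ | ofʸ x | _ | ofⁿ y | _ | _ | _ | _ = ⊥-elim (y (NP.<-trans x (NP.n<1+n p)))
... | _ | ofⁿ x | _ | ofʸ y | _ | _ | _ | _ = ⊥-elim (i≢p (NP.≤-antisym (NP.≤-pred y) (NP.≮⇒≥ x)))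
... | _ | _ | _ | _ | _ | ofⁿ x | _ | ofʸ y = ⊥-elim (x (NP.<-trans (NP.n<1+n p) y))
... | _ | _ | _ | _ | _ | ofʸ x | _ | ofⁿ y = ⊥-elim (j≢q (NP.≤-antisym (NP.≮⇒≥ y) x))
... | _ | ofʸ _ | _ | ofʸ _ | _ | ofʸ _ | _ | ofʸ _ = refl
... | _ | ofʸ _ | _ | ofʸ _ | _ | ofⁿ _ | _ | ofⁿ _ = refl
... | _ | ofⁿ _ | _ | ofⁿ _ | _ | _ | _ | _ = refl

offPair : ∀ {n} → Fin n → Fin n → (Fin n → ℕ) → Fin n → ℕ
offPair i j f k = if does (k FP.≟ i) then 0 else if does (k FP.≟ j) then 0 else f k

∑-split-pair : ∀ {n} {i j : Fin n} → i ≢ j → ∀ (f : Fin n → ℕ) → ∑ f ≡ f i + f j + ∑ (offPair i j f)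
∑-split-pair {n} {i} {j} i≢j f = begin
  ∑ f                                                      ≡⟨ ∑-cong pointwise ⟩
  ∑ (λ k → (δi k + δj k) + offPair i j f k)               ≡⟨ ∑-+ (λ k → δi k + δj k) (offPair i j f) ⟩
  ∑ (λ k → δi k + δj k) + ∑ (offPair i j f)               ≡⟨ cong (_+ ∑ (offPair i j f)) (∑-+ δi δj) ⟩
  ∑ δi + ∑ δj + ∑ (offPair i j f)                          ≡⟨ cong₂ (λ a b → a + b + ∑ (offPair i j f)) (∑-δ i f) (∑-δ j f) ⟩
  f i + f j + ∑ (offPair i j f)                            ∎
  where
  open ≡-Reasoning
  δi δj : Fin n → ℕ
  δi k = 𝟙 (k FP.≟ i) * f k
  δj k = 𝟙 (k FP.≟ j) * f k
  pointwise : ∀ k → f k ≡ (δi k + δj k) + offPair i j f k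
  pointwise k with k FP.≟ i | k FP.≟ j
  ... | yes k≡i | yes k≡j = ⊥-elim (i≢j (trans (sym k≡i) k≡j))
  ... | yes _ | no _ = sym (trans (NP.+-identityʳ _) (trans (NP.+-identityʳ _) (NP.+-identityʳ (f k))))
  ... | no _ | yes _ = sym (trans (NP.+-identityʳ _) (NP.+-identityʳ (f k)))
  ... | no _ | no _ = refl

offPair-cong : ∀ {n} {i j : Fin n} {f g : Fin n → ℕ} → (∀ k → k ≢ i → k ≢ j → f k ≡ g k) →
  ∀ k → offPair i j f k ≡ offPair i j g k
offPair-cong {i = i} {j} f≡g k with k FP.≟ i | k FP.≟ j
... | yes _ | _ = refl
... | no _ | yes _ = refl
... | no k≢i | no k≢j = f≡g k k≢i k≢j

offPair-+ : ∀ {n} {i j : Fin n} (g h : Fin n → ℕ) → h i ≡ 0 → h j ≡ 0 →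
  ∀ k → offPair i j (λ k → g k + h k) k ≡ offPair i j g k + h k
offPair-+ {i = i} {j} g h hi≡0 hj≡0 k with k FP.≟ i | k FP.≟ j
... | yes refl | _ = sym hi≡0
... | no _ | yes refl = sym hj≡0
... | no _ | no _ = refl

-- Inversions and the length of a transposition

inversionAt : ∀ {n} → Vec ℕ n → Fin n → Fin n → Fin n → Fin n → ℕ
inversionAt u x y p q = 𝟙 (toℕ x <? toℕ y) * 𝟙 (u ! q <? u ! p)

invCount : ∀ {n} → Vec ℕ n → ℕ
invCount u = ∑ (λ p → ∑ (λ q → inversionAt u p q p q))

len≡invCount : ∀ {n} (u : Vec ℕ n) → len u ≡ invCount u
len≡invCount {n} u = trans (length-filter _ (pairs n)) (trans (ℕSum.sumOver-pairs n _)
  (∑-cong (λ p → ∑-cong (λ q → when-𝟙 (toℕ p <? toℕ q) (𝟙 (u ! q <? u ! p))))))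

invCount-ext : ∀ {n} (u v : Vec ℕ n) → (∀ k → u ! k ≡ v ! k) → invCount u ≡ invCount v
invCount-ext u v e =
  ∑-cong (λ p → ∑-cong (λ q → cong₂ (λ x y → 𝟙 (toℕ p <? toℕ q) * 𝟙 (x <? y)) (e q) (e p)))

invCount-swap : ∀ {n} (u : Vec ℕ n) (i j : Fin n) →
  invCount (swap u i j) ≡ ∑ (λ p → ∑ (λ q → inversionAt u (τ i j p) (τ i j q) p q))
invCount-swap u i j = begin
  invCount v                                          ≡⟨ ∑-τ i j (λ p → ∑ (λ q → inversionAt v p q p q)) ⟩
  ∑ (λ p → ∑ (λ q → inversionAt v (τ i j p) q (τ i j p) q))
    ≡⟨ ∑-cong (λ p → ∑-τ i j (λ q → inversionAt v (τ i j p) q (τ i j p) q)) ⟩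
  ∑ (λ p → ∑ (λ q → inversionAt v (τ i j p) (τ i j q) (τ i j p) (τ i j q)))
    ≡⟨ ∑-cong (λ p → ∑-cong (λ q → cong₂ (λ x y → 𝟙 (toℕ (τ i j p) <? toℕ (τ i j q)) * 𝟙 (x <? y))
                                           (v∘τ≡u q) (v∘τ≡u p))) ⟩
  ∑ (λ p → ∑ (λ q → inversionAt u (τ i j p) (τ i j q) p q)) ∎
  where
  open ≡-Reasoning
  v = swap u i j
  v∘τ≡u : ∀ k → v ! τ i j k ≡ u ! k
  v∘τ≡u k = trans (lookup-swap u i j (τ i j k)) (cong (u !_) (τ-involutive i j k))

between : ∀ {n} → Vec ℕ n → Fin n → Fin n → ℕ
between u i j = ∑ (λ m → inside (toℕ i) (toℕ j) (toℕ m) * 𝟙 (u ! j <? u ! m) * 𝟙 (u ! m <? u ! i))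

module _ {n} (u : Vec ℕ n) (u-distinct : Distinct u) {i j : Fin n}
         (i<j : toℕ i < toℕ j) (uj<ui : u ! j < u ! i) where
  private
    open ≡-Reasoning

    L R : Fin n → Fin n → ℕ
    L p q = inversionAt u p q p q
    R p q = inversionAt u (τ i j p) (τ i j q) p q

    defect : Fin n → ℕ
    defect m = inside (toℕ i) (toℕ j) (toℕ m) * 𝟙 (u ! j <? u ! m) * 𝟙 (u ! m <? u ! i)

    i≢j : i ≢ j
    i≢j refl = NP.<-irrefl refl i<j

    toℕ-≢ : ∀ {p q : Fin n} → p ≢ q → toℕ p ≢ toℕ q
    toℕ-≢ p≢q = p≢q ∘ FP.toℕ-injective

    value-≢ : ∀ {p q : Fin n} → p ≢ q → u ! p ≢ u ! q
    value-≢ p≢q = p≢q ∘ u-distinct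

    shuffle₁ : ∀ x c o → (x + c) + o ≡ x + o + c
    shuffle₁ = solve-∀

    shuffle₂ : ∀ ri rj o c → (ri + rj + (1 + c)) + (o + c) ≡ suc ((ri + rj + o) + (c + c))
    shuffle₂ = solve-∀

    row-outside : ∀ p → p ≢ i → p ≢ j → ∑ (L p) ≡ ∑ (R p) + defect p
    row-outside p p≢i p≢j = begin
      ∑ (L p)                                            ≡⟨ ∑-split-pair i≢j (L p) ⟩
      L p i + L p j + ∑ (offPair i j (L p))              ≡⟨ cong (_+ ∑ (offPair i j (L p))) entries-i-j ⟩
      (R p i + R p j + defect p) + ∑ (offPair i j (L p)) ≡⟨ shuffle₁ (R p i + R p j) (defect p) _ ⟩
      R p i + R p j + ∑ (offPair i j (L p)) + defect p   ≡⟨ cong (λ z → R p i + R p j + z + defect p) (∑-cong (offPair-cong off-i-j)) ⟩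
      R p i + R p j + ∑ (offPair i j (R p)) + defect p   ≡⟨ cong (_+ defect p) (sym (∑-split-pair i≢j (R p))) ⟩
      ∑ (R p) + defect p                                 ∎
      where
      τp≡p = τ-away p≢i p≢j
      entries-i-j : L p i + L p j ≡ R p i + R p j + defect p
      entries-i-j = trans
        (inversions-row (toℕ p) (toℕ i) (toℕ j) (u ! i) (u ! j) (u ! p) i<j uj<ui
                        (value-≢ p≢i) (value-≢ p≢j) (toℕ-≢ p≢i) (toℕ-≢ p≢j))
        (cong (_+ defect p) (sym (cong₂ _+_ (cong₂ (λ x y → inversionAt u x y p i) τp≡p (τ-i i j))
                                            (cong₂ (λ x y → inversionAt u x y p j) τp≡p (τ-j i j)))))
      off-i-j : ∀ q → q ≢ i → q ≢ j → L p q ≡ R p q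
      off-i-j q q≢i q≢j = sym (cong₂ (λ x y → inversionAt u x y p q) τp≡p (τ-away q≢i q≢j))

    columns-i-j : ∀ q → TransposeCase i j q (τ i j q) → L i q + L j q ≡ (R i q + R j q) + (𝟙 (q FP.≟ j) + defect q)
    columns-i-j q (at-i refl τq≡j) = trans (inversions-column-i (toℕ i) (toℕ j) (u ! i) (u ! j) i<j uj<ui)
      (cong₂ (λ x y → x + (y + defect i))
        (sym (cong₂ _+_ (cong₂ (λ x y → inversionAt u x y i i) τq≡j τq≡j)
                        (cong₂ (λ x y → inversionAt u x y j i) (τ-j i j) τq≡j)))
        (sym (𝟙-no (i FP.≟ j) i≢j)))
    columns-i-j q (at-j _ refl τq≡i) = trans (inversions-column-j (toℕ i) (toℕ j) (u ! i) (u ! j) i<j uj<ui)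
      (cong₂ (λ x y → x + (y + defect j))
        (sym (cong₂ _+_ (cong₂ (λ x y → inversionAt u x y i j) (τ-i i j) τq≡i)
                        (cong₂ (λ x y → inversionAt u x y j j) τq≡i τq≡i)))
        (sym (𝟙-yes (j FP.≟ j) refl)))
    columns-i-j q (away q≢i q≢j τq≡q) =
      trans (inversions-column (toℕ q) (toℕ i) (toℕ j) (u ! i) (u ! j) (u ! q) i<j uj<ui
                               (value-≢ q≢i) (value-≢ q≢j) (toℕ-≢ q≢i) (toℕ-≢ q≢j))
      (cong₂ (λ x y → x + (y + defect q))
        (sym (cong₂ _+_ (cong₂ (λ x y → inversionAt u x y i q) (τ-i i j) τq≡q)
                        (cong₂ (λ x y → inversionAt u x y j q) (τ-j i j) τq≡q)))
        (sym (𝟙-no (q FP.≟ j) q≢j)))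

    rows-i-j : ∑ (L i) + ∑ (L j) ≡ ∑ (R i) + ∑ (R j) + (1 + between u i j)
    rows-i-j = begin
      ∑ (L i) + ∑ (L j)                                          ≡⟨ sym (∑-+ (L i) (L j)) ⟩
      ∑ (λ q → L i q + L j q)                                    ≡⟨ ∑-cong (λ q → columns-i-j q (transpose-case i j q)) ⟩
      ∑ (λ q → (R i q + R j q) + (𝟙 (q FP.≟ j) + defect q))      ≡⟨ ∑-+ (λ q → R i q + R j q) (λ q → 𝟙 (q FP.≟ j) + defect q) ⟩
      ∑ (λ q → R i q + R j q) + ∑ (λ q → 𝟙 (q FP.≟ j) + defect q)
        ≡⟨ cong₂ _+_ (∑-+ (R i) (R j)) (trans (∑-+ (λ q → 𝟙 (q FP.≟ j)) defect) (cong (_+ between u i j) ∑-δj)) ⟩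
      ∑ (R i) + ∑ (R j) + (1 + between u i j)                    ∎
      where
      ∑-δj : ∑ (λ q → 𝟙 (q FP.≟ j)) ≡ 1
      ∑-δj = trans (∑-cong (λ q → sym (NP.*-identityʳ (𝟙 (q FP.≟ j))))) (∑-δ j (λ _ → 1))

    rows-outside : ∀ p → offPair i j (λ p → ∑ (L p)) p ≡ offPair i j (λ p → ∑ (R p)) p + defect p
    rows-outside p = trans (offPair-cong row-outside p) (offPair-+ (λ p → ∑ (R p)) defect defect-i defect-j p)
      where
      defect-i : defect i ≡ 0
      defect-i = cong (λ z → z * 𝟙 (u ! j <? u ! i) * 𝟙 (u ! i <? u ! i)) (inside-≤ {toℕ i} {toℕ j} NP.≤-refl)
      defect-j : defect j ≡ 0
      defect-j = cong (λ z → z * 𝟙 (u ! j <? u ! j) * 𝟙 (u ! j <? u ! i)) (inside-≥ {toℕ i} {toℕ j} NP.≤-refl)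

  invCount-transposition : invCount u ≡ suc (invCount (swap u i j) + (between u i j + between u i j))
  invCount-transposition = begin
    invCount u                                                  ≡⟨ ∑-split-pair i≢j (λ p → ∑ (L p)) ⟩
    ∑ (L i) + ∑ (L j) + ∑ (offPair i j (λ p → ∑ (L p)))
      ≡⟨ cong₂ _+_ rows-i-j (trans (∑-cong rows-outside) (∑-+ (offPair i j (λ p → ∑ (R p))) defect)) ⟩
    (∑ (R i) + ∑ (R j) + (1 + C)) + (∑ (offPair i j (λ p → ∑ (R p))) + C)
      ≡⟨ shuffle₂ (∑ (R i)) (∑ (R j)) (∑ (offPair i j (λ p → ∑ (R p)))) C ⟩
    suc ((∑ (R i) + ∑ (R j) + ∑ (offPair i j (λ p → ∑ (R p)))) + (C + C))
      ≡⟨ cong (λ z → suc (z + (C + C))) (sym (trans (invCount-swap u i j) (∑-split-pair i≢j (λ p → ∑ (R p))))) ⟩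
    suc (invCount (swap u i j) + (C + C))                       ∎
    where C = between u i j

len-transposition : ∀ {n} (u : Vec ℕ n) → Distinct u → ∀ {i j : Fin n} → toℕ i < toℕ j → u ! j < u ! i →
  len u ≡ suc (len (swap u i j) + (between u i j + between u i j))
len-transposition u u-distinct {i} {j} i<j uj<ui = begin
  len u                                                      ≡⟨ len≡invCount u ⟩
  invCount u                                                 ≡⟨ invCount-transposition u u-distinct i<j uj<ui ⟩
  suc (invCount (swap u i j) + (between u i j + between u i j))
    ≡⟨ cong (λ z → suc (z + (between u i j + between u i j))) (sym (len≡invCount (swap u i j))) ⟩
  suc (len (swap u i j) + (between u i j + between u i j))   ∎
  where open ≡-Reasoning

len-swap-swap : ∀ {n} (u : Vec ℕ n) (i j : Fin n) → len (swap (swap u i j) i j) ≡ len u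
len-swap-swap u i j = trans (len≡invCount (swap (swap u i j) i j))
  (trans (invCount-ext (swap (swap u i j) i j) u (lookup-swap-swap u i j)) (sym (len≡invCount u)))

Covers : ∀ {n} → Vec ℕ n → Fin n → Fin n → Set
Covers u i j = suc (len (swap u i j)) ≡ len u

Ascent : ∀ {n} → Vec ℕ n → Fin n → Fin n → Set
Ascent u p q = (toℕ q ≡ suc (toℕ p)) × (len (swap u p q) ≡ suc (len u))

module _ {n} (u : Vec ℕ n) (u-distinct : Distinct u) {i j : Fin n} (i<j : toℕ i < toℕ j) where

  covers⇒ : Covers u i j → (u ! j < u ! i) × (between u i j ≡ 0)
  covers⇒ covers with NP.<-cmp (u ! j) (u ! i)
  ... | tri< uj<ui _ _ = uj<ui , NP.m+n≡0⇒m≡0 C (NP.+-cancelˡ-≡ (len v) (C + C) 0 len-v-cancel)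
    where
    v = swap u i j
    C = between u i j
    len-v-cancel : len v + (C + C) ≡ len v + 0
    len-v-cancel = trans (sym (NP.suc-injective (trans covers (len-transposition u u-distinct i<j uj<ui))))
                         (sym (NP.+-identityʳ (len v)))
  ... | tri≈ _ uj≡ui _ = ⊥-elim (NP.<-irrefl (sym (cong toℕ (u-distinct uj≡ui))) i<j)
  ... | tri> _ _ ui<uj = ⊥-elim (NP.m≢1+m+n (len u) (trans len-u-grows (cong suc (sym (NP.+-suc (len u) X)))))
    where
    v = swap u i j
    X = between v i j + between v i j
    vj<vi : v ! j < v ! i
    vj<vi = subst₂ _<_ (sym (lookup-swap-j u i j)) (sym (lookup-swap-i u i j)) ui<uj
    len-u-grows : len u ≡ suc (suc (len u + X))
    len-u-grows = trans (sym covers) (cong suc (trans (len-transposition v (swap-distinct u i j u-distinct) i<j vj<vi)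
                                                      (cong (λ z → suc (z + X)) (len-swap-swap u i j))))

  covers⇐ : u ! j < u ! i → between u i j ≡ 0 → Covers u i j
  covers⇐ uj<ui C≡0 = sym (trans (len-transposition u u-distinct i<j uj<ui)
    (cong suc (trans (cong (λ z → len (swap u i j) + (z + z)) C≡0) (NP.+-identityʳ _))))

between-adjacent : ∀ {n} (v : Vec ℕ n) (p q : Fin n) → toℕ q ≡ suc (toℕ p) → between v p q ≡ 0
between-adjacent {n} v p q q≡1+p = trans (∑-cong (λ m → cong (λ z → z * 𝟙 (v ! q <? v ! m) * 𝟙 (v ! m <? v ! p))
  (trans (cong (λ z → inside (toℕ p) z (toℕ m)) q≡1+p) (inside-suc (toℕ p) (toℕ m))))) (∑-zero n)

module _ {n} (u : Vec ℕ n) (u-distinct : Distinct u) {p q : Fin n} where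

  ascent⇒< : Ascent u p q → u ! p < u ! q
  ascent⇒< (q≡1+p , ascent) = subst₂ _<_ (lookup-swap-j u p q) (lookup-swap-i u p q)
    (proj₁ (covers⇒ (swap u p q) (swap-distinct u p q u-distinct) p<q (trans (cong suc (len-swap-swap u p q)) (sym ascent))))
    where p<q = subst (toℕ p <_) (sym q≡1+p) NP.≤-refl

  <⇒ascent : toℕ q ≡ suc (toℕ p) → u ! p < u ! q → Ascent u p q
  <⇒ascent q≡1+p up<uq = q≡1+p , sym (trans (sym (cong suc (len-swap-swap u p q)))
    (covers⇐ (swap u p q) (swap-distinct u p q u-distinct) p<q
             (subst₂ _<_ (sym (lookup-swap-j u p q)) (sym (lookup-swap-i u p q)) up<uq)
             (between-adjacent (swap u p q) p q q≡1+p)))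
    where p<q = subst (toℕ p <_) (sym q≡1+p) NP.≤-refl

countValues : ∀ {n} → Vec ℕ n → (Fin n → ℕ) → ℕ → ℕ → ℕ
countValues x P lo hi = ∑ (λ m → P m * 𝟙 (lo <? x ! m) * 𝟙 (x ! m <? hi))

module _ {n} (x : Vec ℕ n) (lo hi : ℕ) where

  countValues-cong : ∀ {P P′ : Fin n → ℕ} → (∀ m → P m ≡ P′ m) → countValues x P lo hi ≡ countValues x P′ lo hi
  countValues-cong e = ∑-cong (λ m → cong (λ z → z * 𝟙 (lo <? x ! m) * 𝟙 (x ! m <? hi)) (e m))

  countValues-+ : ∀ (P P′ : Fin n → ℕ) →
    countValues x (λ m → P m + P′ m) lo hi ≡ countValues x P lo hi + countValues x P′ lo hi
  countValues-+ P P′ = trans (∑-cong (λ m → distrib (P m) (P′ m) _ _))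
    (∑-+ (λ m → P m * 𝟙 (lo <? x ! m) * 𝟙 (x ! m <? hi)) (λ m → P′ m * 𝟙 (lo <? x ! m) * 𝟙 (x ! m <? hi)))
    where
    distrib : ∀ a b c d → (a + b) * c * d ≡ a * c * d + b * c * d
    distrib = solve-∀

  countValues-δ : ∀ k → countValues x (λ m → 𝟙 (m FP.≟ k)) lo hi ≡ 𝟙 (lo <? x ! k) * 𝟙 (x ! k <? hi)
  countValues-δ k = trans (∑-cong (λ m → NP.*-assoc (𝟙 (m FP.≟ k)) _ _))
    (∑-δ k (λ m → 𝟙 (lo <? x ! m) * 𝟙 (x ! m <? hi)))

τ-invariant : ∀ {n} (P : Fin n → ℕ) (p q : Fin n) → P p ≡ P q → ∀ m → P (τ p q m) ≡ P m
τ-invariant P p q Pp≡Pq m with transpose-case p q m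
... | at-i refl τm≡q = trans (cong P τm≡q) (sym Pp≡Pq)
... | at-j _ refl τm≡p = trans (cong P τm≡p) Pp≡Pq
... | away _ _ τm≡m = cong P τm≡m

countValues-swap : ∀ {n} (u : Vec ℕ n) (P : Fin n → ℕ) (lo hi : ℕ) (p q : Fin n) → P p ≡ P q →
  countValues (swap u p q) P lo hi ≡ countValues u P lo hi
countValues-swap u P lo hi p q Pp≡Pq =
  trans (∑-τ p q (λ m → P m * 𝟙 (lo <? swap u p q ! m) * 𝟙 (swap u p q ! m <? hi)))
        (∑-cong (λ m → cong₂ (λ z y → z * 𝟙 (lo <? y) * 𝟙 (y <? hi)) (τ-invariant P p q Pp≡Pq m)
                                 (trans (lookup-swap u p q (τ p q m)) (cong (u !_) (τ-involutive p q m)))))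

aCount≡countValues : ∀ {n} (x : Vec ℕ n) (i j : Fin n) →
  aCount x i j ≡ countValues x (λ m → 𝟙 (toℕ m <? toℕ i)) (x ! j) (x ! i)
aCount≡countValues {n} x i j = trans (length-filter _ (allFin n)) (trans (ℕSum.sumOver-allFin n _)
  (∑-cong (λ m → trans (𝟙-×-dec (toℕ m <? toℕ i) ((x ! j <? x ! m) ×-dec (x ! m <? x ! i)))
    (trans (cong (𝟙 (toℕ m <? toℕ i) *_) (𝟙-×-dec (x ! j <? x ! m) (x ! m <? x ! i)))
           (sym (NP.*-assoc (𝟙 (toℕ m <? toℕ i)) (𝟙 (x ! j <? x ! m)) (𝟙 (x ! m <? x ! i))))))))

-- Transposing adjacent positions

dCoeff-cong : ∀ {n} (x y : Vec ℕ n) (i j k l : Fin n) → x ! i ≡ y ! k → x ! j ≡ y ! l → aCount x i j ≡ aCount y k l →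
  dCoeff x i j ≡ dCoeff y k l
dCoeff-cong x y i j k l xi≡yk xj≡yl a≡a′ rewrite xi≡yk | xj≡yl | a≡a′ = refl

𝟙-yes-*ˡ : ∀ {p} {P : Set p} (d : Dec P) → P → ∀ z → 𝟙 d * z ≡ 0 → z ≡ 0
𝟙-yes-*ˡ d holds z e = trans (sym (NP.*-identityˡ z)) (trans (cong (_* z) (sym (𝟙-yes d holds))) e)

𝟙-yes-*ʳ : ∀ {p} {P : Set p} (d : Dec P) → P → ∀ z → z * 𝟙 d ≡ 0 → z ≡ 0
𝟙-yes-*ʳ d holds z e = trans (sym (NP.*-identityʳ z)) (trans (cong (z *_) (sym (𝟙-yes d holds))) e)

module AdjacentTransposition {n} (u : Vec ℕ n) (u-distinct : Distinct u) (p q : Fin n)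
                             (q≡1+p : toℕ q ≡ suc (toℕ p)) where
  s = τ p q
  us = swap u p q
  a = u ! p
  b = u ! q

  us-distinct : Distinct us
  us-distinct = swap-distinct u p q u-distinct

  DownUp : Fin n → Fin n → Set
  DownUp i j = (toℕ i < toℕ j) × Covers u i j × Ascent (swap u i j) p q

  UpDown : Fin n → Fin n → Set
  UpDown x y = Ascent u p q × (toℕ x < toℕ y) × Covers us x y

  Matching : Fin n → Fin n → Fin n → Fin n → Set
  Matching i j x y = (DownUp i j → UpDown x y) × (UpDown x y → DownUp i j) × (DownUp i j → dCoeff u i j ≡ dCoeff us x y)

  p<q : toℕ p < toℕ q
  p<q = subst (toℕ p <_) (sym q≡1+p) (NP.n<1+n (toℕ p))

  p≢q : p ≢ q
  p≢q e = NP.<-irrefl (cong toℕ e) p<q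

  a≢b : a ≢ b
  a≢b = p≢q ∘ u-distinct

  usp : us ! p ≡ b
  usp = lookup-swap-i u p q

  usq : us ! q ≡ a
  usq = lookup-swap-j u p q

  uso : ∀ {m} → m ≢ p → m ≢ q → us ! m ≡ u ! m
  uso = lookup-swap-away u

  <⇒≢ : ∀ {x y : Fin n} → toℕ x < toℕ y → x ≢ y
  <⇒≢ x<y x≡y = NP.<-irrefl (cong toℕ x≡y) x<y

  >⇒≢ : ∀ {x y : Fin n} → toℕ x < toℕ y → y ≢ x
  >⇒≢ x<y y≡x = NP.<-irrefl (cong toℕ (sym y≡x)) x<y

  toℕ-≢ : ∀ {x y : Fin n} → x ≢ y → toℕ x ≢ toℕ y
  toℕ-≢ x≢y = x≢y ∘ FP.toℕ-injective

  within : Fin n → Fin n → Fin n → ℕ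
  within x j m = inside (toℕ x) (toℕ j) (toℕ m)

  below : Fin n → Fin n → ℕ
  below i m = 𝟙 (toℕ m <? toℕ i)

  within-from-p : ∀ j → toℕ q < toℕ j → ∀ m → within p j m ≡ 𝟙 (m FP.≟ q) + within q j m
  within-from-p j q<j m = trans (inside-suc-left (toℕ p) (toℕ j) (toℕ m) (subst (_< toℕ j) q≡1+p q<j))
     (subst (λ z → 𝟙 (toℕ m ≟ z) + inside z (toℕ j) (toℕ m) ≡ 𝟙 (m FP.≟ q) + within q j m) q≡1+p
        (cong (_+ within q j m) (sym (𝟙-≟-toℕ m q))))

  within-to-q : ∀ i → toℕ i < toℕ p → ∀ m → within i q m ≡ within i p m + 𝟙 (m FP.≟ p)
  within-to-q i i<p m = trans (cong (λ z → inside (toℕ i) z (toℕ m)) q≡1+p)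
    (trans (inside-suc-right (toℕ i) (toℕ p) (toℕ m) i<p) (cong (λ z → within i p m + z) (sym (𝟙-≟-toℕ m p))))

  below-q : ∀ m → below q m ≡ below p m + 𝟙 (m FP.≟ p)
  below-q m = trans (cong (λ z → 𝟙 (toℕ m <? z)) q≡1+p)
    (trans (𝟙<suc (toℕ p) (toℕ m)) (cong (λ z → below p m + z) (sym (𝟙-≟-toℕ m p))))

  -- The weights below take the same value at p and at q, so countValues-swap moves them between u and u s.
  within-from-q-p≡q : ∀ j → within q j p ≡ within q j q
  within-from-q-p≡q j = trans (inside-≤ {toℕ q} {toℕ j} {toℕ p} (NP.<⇒≤ p<q)) (sym (inside-≤ {toℕ q} {toℕ j} {toℕ q} NP.≤-refl))

  within-to-p-p≡q : ∀ i → within i p p ≡ within i p q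
  within-to-p-p≡q i = trans (inside-≥ {toℕ i} {toℕ p} {toℕ p} NP.≤-refl) (sym (inside-≥ {toℕ i} {toℕ p} {toℕ q} (NP.<⇒≤ p<q)))

  below-p-p≡q : below p p ≡ below p q
  below-p-p≡q = trans (𝟙-no (toℕ p <? toℕ p) (NP.<-irrefl refl)) (sym (𝟙-no (toℕ q <? toℕ p) (NP.<-asym p<q)))

  below-p≡q : ∀ i → i ≢ p → i ≢ q → below i p ≡ below i q
  below-p≡q i i≢p i≢q = trans (𝟙-suc-< (toℕ i) (toℕ p) (toℕ-≢ i≢p) (λ e → toℕ-≢ i≢q (trans e (sym q≡1+p))))
    (cong (λ z → 𝟙 (z <? toℕ i)) (sym q≡1+p))

  within-p≡q : ∀ i j → i ≢ p → i ≢ q → j ≢ p → j ≢ q → within i j p ≡ within i j q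
  within-p≡q i j i≢p i≢q j≢p j≢q =
    trans (inside-at-suc (toℕ i) (toℕ j) (toℕ p) (toℕ-≢ i≢p) (λ e → toℕ-≢ i≢q (trans e (sym q≡1+p)))
                         (toℕ-≢ j≢p) (λ e → toℕ-≢ j≢q (trans e (sym q≡1+p))))
          (cong (inside (toℕ i) (toℕ j)) (sym q≡1+p))

  -- When one of i , j lies in {p , q}, between and aCount on the two sides differ by a single term
  -- 𝟙[c < u_p < d] or 𝟙[c < u_q < d], and the ascent condition u_p < u_q decides whether it vanishes.
  module From-p (j : Fin n) (q<j : toℕ q < toℕ j) where
    p<j = NP.<-trans p<q q<j
    j≢p : j ≢ p
    j≢p = >⇒≢ p<j
    j≢q : j ≢ q
    j≢q = >⇒≢ q<j
    ut = swap u p j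
    ut-distinct : Distinct ut
    ut-distinct = swap-distinct u p j u-distinct
    utp : ut ! p ≡ u ! j
    utp = lookup-swap-i u p j
    utq : ut ! q ≡ b
    utq = lookup-swap-away u (>⇒≢ p<q) (<⇒≢ q<j)
    usj : us ! j ≡ u ! j
    usj = uso j≢p j≢q

    between-rel : between u p j ≡ 𝟙 (u ! j <? b) * 𝟙 (b <? a) + between us q j
    between-rel = begin
      between u p j ≡⟨ countValues-cong u (u ! j) a (within-from-p j q<j) ⟩
      countValues u (λ m → 𝟙 (m FP.≟ q) + within q j m) (u ! j) a ≡⟨ countValues-+ u (u ! j) a (λ m → 𝟙 (m FP.≟ q)) (within q j) ⟩
      countValues u (λ m → 𝟙 (m FP.≟ q)) (u ! j) a + countValues u (within q j) (u ! j) a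
        ≡⟨ cong₂ _+_ (countValues-δ u (u ! j) a q) (sym (countValues-swap u (within q j) (u ! j) a p q (within-from-q-p≡q j))) ⟩
      𝟙 (u ! j <? b) * 𝟙 (b <? a) + countValues us (within q j) (u ! j) a
        ≡⟨ cong₂ (λ z w → 𝟙 (u ! j <? b) * 𝟙 (b <? a) + countValues us (within q j) z w) (sym usj) (sym usq) ⟩
      𝟙 (u ! j <? b) * 𝟙 (b <? a) + between us q j ∎
      where open ≡-Reasoning

    aCount-rel : aCount us q j ≡ aCount u p j + 𝟙 (u ! j <? b) * 𝟙 (b <? a)
    aCount-rel = begin
      aCount us q j ≡⟨ aCount≡countValues us q j ⟩
      countValues us (below q) (us ! j) (us ! q) ≡⟨ cong₂ (countValues us (below q)) usj usq ⟩
      countValues us (below q) (u ! j) a ≡⟨ countValues-cong us (u ! j) a below-q ⟩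
      countValues us (λ m → 𝟙 (toℕ m <? toℕ p) + 𝟙 (m FP.≟ p)) (u ! j) a
        ≡⟨ countValues-+ us (u ! j) a (below p) (λ m → 𝟙 (m FP.≟ p)) ⟩
      countValues us (below p) (u ! j) a + countValues us (λ m → 𝟙 (m FP.≟ p)) (u ! j) a
        ≡⟨ cong₂ _+_ (countValues-swap u (below p) (u ! j) a p q below-p-p≡q) (countValues-δ us (u ! j) a p) ⟩
      countValues u (below p) (u ! j) a + 𝟙 (u ! j <? us ! p) * 𝟙 (us ! p <? a)
        ≡⟨ cong₂ _+_ (sym (aCount≡countValues u p j)) (cong (λ z → 𝟙 (u ! j <? z) * 𝟙 (z <? a)) usp) ⟩
      aCount u p j + 𝟙 (u ! j <? b) * 𝟙 (b <? a) ∎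
      where open ≡-Reasoning

    forward : DownUp p j → UpDown q j
    forward (_ , cov , up) = <⇒ascent u u-distinct q≡1+p a<b , q<j , covers⇐ us us-distinct q<j (subst₂ _<_ (sym usj) (sym usq) j<a) C0
      where
      cv = covers⇒ u u-distinct p<j cov
      j<a = proj₁ cv
      s0 : 𝟙 (u ! j <? b) * 𝟙 (b <? a) + between us q j ≡ 0
      s0 = trans (sym between-rel) (proj₂ cv)
      C0 = NP.m+n≡0⇒n≡0 (𝟙 (u ! j <? b) * 𝟙 (b <? a)) s0
      jb : u ! j < b
      jb = subst₂ _<_ utp utq (ascent⇒< ut ut-distinct up)
      ba0 : 𝟙 (b <? a) ≡ 0
      ba0 = trans (sym (NP.*-identityˡ _)) (trans (cong (_* 𝟙 (b <? a)) (sym (𝟙-yes (u ! j <? b) jb)))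
              (NP.m+n≡0⇒m≡0 (𝟙 (u ! j <? b) * 𝟙 (b <? a)) s0))
      a<b = ≮∧≢⇒> (𝟙≡0⇒¬ (b <? a) ba0) (λ e → a≢b (sym e))

    backward : UpDown q j → DownUp p j
    backward (up , _ , cov') = p<j , covers⇐ u u-distinct p<j j<a Cu0 , <⇒ascent ut ut-distinct q≡1+p (subst₂ _<_ (sym utp) (sym utq) (NP.<-trans j<a a<b))
      where
      a<b = ascent⇒< u u-distinct up
      cv = covers⇒ us us-distinct q<j cov'
      j<a : u ! j < a
      j<a = subst₂ _<_ usj usq (proj₁ cv)
      ba0 : 𝟙 (b <? a) ≡ 0
      ba0 = 𝟙-no (b <? a) (NP.<-asym a<b)
      Cu0 : between u p j ≡ 0
      Cu0 = trans between-rel (cong₂ _+_ (trans (cong (𝟙 (u ! j <? b) *_) ba0) (NP.*-zeroʳ (𝟙 (u ! j <? b)))) (proj₂ cv))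

    dCoeff-eq : DownUp p j → dCoeff u p j ≡ dCoeff us q j
    dCoeff-eq pa = dCoeff-cong u us p j q j (sym usq) (sym usj)
      (sym (trans aCount-rel (trans (cong (λ z → aCount u p j + 𝟙 (u ! j <? b) * z) ba0)
         (trans (cong (λ z → aCount u p j + z) (NP.*-zeroʳ (𝟙 (u ! j <? b)))) (NP.+-identityʳ _)))))
      where
      a<b = ascent⇒< u u-distinct (proj₁ (forward pa))
      ba0 = 𝟙-no (b <? a) (NP.<-asym a<b)

    matching : Matching p j q j
    matching = forward , backward , dCoeff-eq

  module From-q (j : Fin n) (q<j : toℕ q < toℕ j) where
    p<j = NP.<-trans p<q q<j
    j≢p : j ≢ p
    j≢p = >⇒≢ p<j
    j≢q : j ≢ q
    j≢q = >⇒≢ q<j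
    ut = swap u q j
    ut-distinct : Distinct ut
    ut-distinct = swap-distinct u q j u-distinct
    utp : ut ! p ≡ a
    utp = lookup-swap-away u (<⇒≢ p<q) (<⇒≢ p<j)
    utq : ut ! q ≡ u ! j
    utq = lookup-swap-i u q j
    usj : us ! j ≡ u ! j
    usj = uso j≢p j≢q

    between-rel : between us p j ≡ 𝟙 (u ! j <? a) * 𝟙 (a <? b) + between u q j
    between-rel = begin
      between us p j ≡⟨ cong₂ (countValues us (within p j)) usj usp ⟩
      countValues us (within p j) (u ! j) b ≡⟨ countValues-cong us (u ! j) b (within-from-p j q<j) ⟩
      countValues us (λ m → 𝟙 (m FP.≟ q) + within q j m) (u ! j) b ≡⟨ countValues-+ us (u ! j) b (λ m → 𝟙 (m FP.≟ q)) (within q j) ⟩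
      countValues us (λ m → 𝟙 (m FP.≟ q)) (u ! j) b + countValues us (within q j) (u ! j) b
        ≡⟨ cong₂ _+_ (countValues-δ us (u ! j) b q) (countValues-swap u (within q j) (u ! j) b p q (within-from-q-p≡q j)) ⟩
      𝟙 (u ! j <? us ! q) * 𝟙 (us ! q <? b) + between u q j ≡⟨ cong (λ z → 𝟙 (u ! j <? z) * 𝟙 (z <? b) + between u q j) usq ⟩
      𝟙 (u ! j <? a) * 𝟙 (a <? b) + between u q j ∎
      where open ≡-Reasoning

    aCount-rel : aCount u q j ≡ aCount us p j + 𝟙 (u ! j <? a) * 𝟙 (a <? b)
    aCount-rel = begin
      aCount u q j ≡⟨ aCount≡countValues u q j ⟩
      countValues u (below q) (u ! j) b ≡⟨ countValues-cong u (u ! j) b below-q ⟩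
      countValues u (λ m → 𝟙 (toℕ m <? toℕ p) + 𝟙 (m FP.≟ p)) (u ! j) b
        ≡⟨ countValues-+ u (u ! j) b (below p) (λ m → 𝟙 (m FP.≟ p)) ⟩
      countValues u (below p) (u ! j) b + countValues u (λ m → 𝟙 (m FP.≟ p)) (u ! j) b
        ≡⟨ cong₂ _+_ (sym (countValues-swap u (below p) (u ! j) b p q below-p-p≡q)) (countValues-δ u (u ! j) b p) ⟩
      countValues us (below p) (u ! j) b + 𝟙 (u ! j <? a) * 𝟙 (a <? b)
        ≡⟨ cong (_+ 𝟙 (u ! j <? a) * 𝟙 (a <? b)) (sym (trans (aCount≡countValues us p j) (cong₂ (countValues us (below p)) usj usp))) ⟩
      aCount us p j + 𝟙 (u ! j <? a) * 𝟙 (a <? b) ∎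
      where open ≡-Reasoning

    forward : DownUp q j → UpDown p j
    forward (_ , cov , up) = <⇒ascent u u-distinct q≡1+p a<b , p<j , covers⇐ us us-distinct p<j (subst₂ _<_ (sym usj) (sym usp) jb) C0
      where
      cv = covers⇒ u u-distinct q<j cov
      jb = proj₁ cv
      aj : a < u ! j
      aj = subst₂ _<_ utp utq (ascent⇒< ut ut-distinct up)
      a<b = NP.<-trans aj jb
      C0 : between us p j ≡ 0
      C0 = trans between-rel (trans (cong₂ _+_ (cong (_* 𝟙 (a <? b)) (𝟙-no (u ! j <? a) (NP.<-asym aj))) (proj₂ cv)) refl)

    backward : UpDown p j → DownUp q j
    backward (up , _ , cov') = q<j , covers⇐ u u-distinct q<j jb C0 , <⇒ascent ut ut-distinct q≡1+p (subst₂ _<_ (sym utp) (sym utq) aj)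
      where
      a<b = ascent⇒< u u-distinct up
      cv = covers⇒ us us-distinct p<j cov'
      jb : u ! j < b
      jb = subst₂ _<_ usj usp (proj₁ cv)
      s0 : 𝟙 (u ! j <? a) * 𝟙 (a <? b) + between u q j ≡ 0
      s0 = trans (sym between-rel) (proj₂ cv)
      C0 = NP.m+n≡0⇒n≡0 (𝟙 (u ! j <? a) * 𝟙 (a <? b)) s0
      ja0 = 𝟙-yes-*ʳ (a <? b) a<b (𝟙 (u ! j <? a)) (NP.m+n≡0⇒m≡0 _ s0)
      aj = ≮∧≢⇒> (𝟙≡0⇒¬ (u ! j <? a) ja0) (j≢p ∘ u-distinct)

    dCoeff-eq : DownUp q j → dCoeff u q j ≡ dCoeff us p j
    dCoeff-eq pa@(_ , _ , up) = dCoeff-cong u us q j p j (sym usp) (sym usj)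
      (trans aCount-rel (trans (cong (λ z → aCount us p j + z * 𝟙 (a <? b)) (𝟙-no (u ! j <? a) (NP.<-asym aj)))
         (NP.+-identityʳ _)))
      where
      aj : a < u ! j
      aj = subst₂ _<_ utp utq (ascent⇒< ut ut-distinct up)

    matching : Matching q j p j
    matching = forward , backward , dCoeff-eq

  module To-p (i : Fin n) (i<p : toℕ i < toℕ p) where
    i<q = NP.<-trans i<p p<q
    i≢p : i ≢ p
    i≢p = <⇒≢ i<p
    i≢q : i ≢ q
    i≢q = <⇒≢ i<q
    ut = swap u i p
    ut-distinct : Distinct ut
    ut-distinct = swap-distinct u i p u-distinct
    utp : ut ! p ≡ u ! i
    utp = lookup-swap-j u i p
    utq : ut ! q ≡ b
    utq = lookup-swap-away u (>⇒≢ i<q) (>⇒≢ p<q)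
    usi : us ! i ≡ u ! i
    usi = uso i≢p i≢q

    between-rel : between us i q ≡ between u i p + 𝟙 (a <? b) * 𝟙 (b <? u ! i)
    between-rel = begin
      between us i q ≡⟨ cong₂ (countValues us (within i q)) usq usi ⟩
      countValues us (within i q) a (u ! i) ≡⟨ countValues-cong us a (u ! i) (within-to-q i i<p) ⟩
      countValues us (λ m → within i p m + 𝟙 (m FP.≟ p)) a (u ! i) ≡⟨ countValues-+ us a (u ! i) (within i p) (λ m → 𝟙 (m FP.≟ p)) ⟩
      countValues us (within i p) a (u ! i) + countValues us (λ m → 𝟙 (m FP.≟ p)) a (u ! i)
        ≡⟨ cong₂ _+_ (countValues-swap u (within i p) a (u ! i) p q (within-to-p-p≡q i)) (countValues-δ us a (u ! i) p) ⟩
      between u i p + 𝟙 (a <? us ! p) * 𝟙 (us ! p <? u ! i) ≡⟨ cong (λ z → between u i p + 𝟙 (a <? z) * 𝟙 (z <? u ! i)) usp ⟩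
      between u i p + 𝟙 (a <? b) * 𝟙 (b <? u ! i) ∎
      where open ≡-Reasoning

    aCount-rel : aCount us i q ≡ aCount u i p
    aCount-rel = trans (aCount≡countValues us i q) (trans (cong₂ (countValues us (below i)) usq usi)
             (trans (countValues-swap u (below i) a (u ! i) p q (below-p≡q i i≢p i≢q)) (sym (aCount≡countValues u i p))))

    forward : DownUp i p → UpDown i q
    forward (_ , cov , up) = <⇒ascent u u-distinct q≡1+p a<b , i<q , covers⇐ us us-distinct i<q (subst₂ _<_ (sym usq) (sym usi) ai) C0
      where
      cv = covers⇒ u u-distinct i<p cov
      ai = proj₁ cv
      ib : u ! i < b
      ib = subst₂ _<_ utp utq (ascent⇒< ut ut-distinct up)
      a<b = NP.<-trans ai ib
      C0 : between us i q ≡ 0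
      C0 = trans between-rel (trans (cong₂ _+_ (proj₂ cv) (cong (𝟙 (a <? b) *_) (𝟙-no (b <? u ! i) (NP.<-asym ib)))) (NP.*-zeroʳ (𝟙 (a <? b))))

    backward : UpDown i q → DownUp i p
    backward (up , _ , cov') = i<p , covers⇐ u u-distinct i<p ai C0 , <⇒ascent ut ut-distinct q≡1+p (subst₂ _<_ (sym utp) (sym utq) ib)
      where
      a<b = ascent⇒< u u-distinct up
      cv = covers⇒ us us-distinct i<q cov'
      ai : a < u ! i
      ai = subst₂ _<_ usq usi (proj₁ cv)
      s0 : between u i p + 𝟙 (a <? b) * 𝟙 (b <? u ! i) ≡ 0
      s0 = trans (sym between-rel) (proj₂ cv)
      C0 = NP.m+n≡0⇒m≡0 (between u i p) s0
      bi0 = 𝟙-yes-*ˡ (a <? b) a<b (𝟙 (b <? u ! i)) (NP.m+n≡0⇒n≡0 (between u i p) s0)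
      ib = ≮∧≢⇒> (𝟙≡0⇒¬ (b <? u ! i) bi0) (≢-sym i≢q ∘ u-distinct)

    dCoeff-eq : DownUp i p → dCoeff u i p ≡ dCoeff us i q
    dCoeff-eq _ = dCoeff-cong u us i p i q (sym usi) (sym usq) (sym aCount-rel)

    matching : Matching i p i q
    matching = forward , backward , dCoeff-eq

  module To-q (i : Fin n) (i<p : toℕ i < toℕ p) where
    i<q = NP.<-trans i<p p<q
    i≢p : i ≢ p
    i≢p = <⇒≢ i<p
    i≢q : i ≢ q
    i≢q = <⇒≢ i<q
    ut = swap u i q
    ut-distinct : Distinct ut
    ut-distinct = swap-distinct u i q u-distinct
    utp : ut ! p ≡ a
    utp = lookup-swap-away u (>⇒≢ i<p) (<⇒≢ p<q)
    utq : ut ! q ≡ u ! i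
    utq = lookup-swap-j u i q
    usi : us ! i ≡ u ! i
    usi = uso i≢p i≢q

    between-rel : between u i q ≡ between us i p + 𝟙 (b <? a) * 𝟙 (a <? u ! i)
    between-rel = begin
      between u i q ≡⟨ countValues-cong u b (u ! i) (within-to-q i i<p) ⟩
      countValues u (λ m → within i p m + 𝟙 (m FP.≟ p)) b (u ! i) ≡⟨ countValues-+ u b (u ! i) (within i p) (λ m → 𝟙 (m FP.≟ p)) ⟩
      countValues u (within i p) b (u ! i) + countValues u (λ m → 𝟙 (m FP.≟ p)) b (u ! i)
        ≡⟨ cong₂ _+_ (sym (countValues-swap u (within i p) b (u ! i) p q (within-to-p-p≡q i))) (countValues-δ u b (u ! i) p) ⟩
      countValues us (within i p) b (u ! i) + 𝟙 (b <? a) * 𝟙 (a <? u ! i)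
        ≡⟨ cong (λ z → z + 𝟙 (b <? a) * 𝟙 (a <? u ! i)) (sym (cong₂ (countValues us (within i p)) usp usi)) ⟩
      between us i p + 𝟙 (b <? a) * 𝟙 (a <? u ! i) ∎
      where open ≡-Reasoning

    aCount-rel : aCount us i p ≡ aCount u i q
    aCount-rel = trans (aCount≡countValues us i p) (trans (cong₂ (countValues us (below i)) usp usi)
             (trans (countValues-swap u (below i) b (u ! i) p q (below-p≡q i i≢p i≢q)) (sym (aCount≡countValues u i q))))

    forward : DownUp i q → UpDown i p
    forward (_ , cov , up) = <⇒ascent u u-distinct q≡1+p a<b , i<p , covers⇐ us us-distinct i<p (subst₂ _<_ (sym usp) (sym usi) bi) C0
      where
      cv = covers⇒ u u-distinct i<q cov
      bi = proj₁ cv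
      ai : a < u ! i
      ai = subst₂ _<_ utp utq (ascent⇒< ut ut-distinct up)
      s0 : between us i p + 𝟙 (b <? a) * 𝟙 (a <? u ! i) ≡ 0
      s0 = trans (sym between-rel) (proj₂ cv)
      C0 = NP.m+n≡0⇒m≡0 (between us i p) s0
      ba0 = 𝟙-yes-*ʳ (a <? u ! i) ai (𝟙 (b <? a)) (NP.m+n≡0⇒n≡0 (between us i p) s0)
      a<b = ≮∧≢⇒> (𝟙≡0⇒¬ (b <? a) ba0) (λ e → a≢b (sym e))

    backward : UpDown i p → DownUp i q
    backward (up , _ , cov') = i<q , covers⇐ u u-distinct i<q bi C0 , <⇒ascent ut ut-distinct q≡1+p (subst₂ _<_ (sym utp) (sym utq) (NP.<-trans a<b bi))
      where
      a<b = ascent⇒< u u-distinct up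
      cv = covers⇒ us us-distinct i<p cov'
      bi : b < u ! i
      bi = subst₂ _<_ usp usi (proj₁ cv)
      C0 : between u i q ≡ 0
      C0 = trans between-rel (cong₂ _+_ (proj₂ cv) (cong (_* 𝟙 (a <? u ! i)) (𝟙-no (b <? a) (NP.<-asym a<b))))

    dCoeff-eq : DownUp i q → dCoeff u i q ≡ dCoeff us i p
    dCoeff-eq _ = dCoeff-cong u us i q i p (sym usi) (sym usp) (sym aCount-rel)

    matching : Matching i q i p
    matching = forward , backward , dCoeff-eq

  module Away (i j : Fin n) (i≢p : i ≢ p) (i≢q : i ≢ q) (j≢p : j ≢ p) (j≢q : j ≢ q) where
    ut = swap u i j
    ut-distinct : Distinct ut
    ut-distinct = swap-distinct u i j u-distinct
    utp : ut ! p ≡ a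
    utp = lookup-swap-away u (≢-sym i≢p) (≢-sym j≢p)
    utq : ut ! q ≡ b
    utq = lookup-swap-away u (≢-sym i≢q) (≢-sym j≢q)
    usi : us ! i ≡ u ! i
    usi = uso i≢p i≢q
    usj : us ! j ≡ u ! j
    usj = uso j≢p j≢q

    between-rel : between us i j ≡ between u i j
    between-rel = trans (cong₂ (countValues us (within i j)) usj usi) (countValues-swap u (within i j) (u ! j) (u ! i) p q (within-p≡q i j i≢p i≢q j≢p j≢q))

    aCount-rel : aCount us i j ≡ aCount u i j
    aCount-rel = trans (aCount≡countValues us i j) (trans (cong₂ (countValues us (below i)) usj usi)
             (trans (countValues-swap u (below i) (u ! j) (u ! i) p q (below-p≡q i i≢p i≢q)) (sym (aCount≡countValues u i j))))

    forward : DownUp i j → UpDown i j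
    forward (i<j , cov , up) = <⇒ascent u u-distinct q≡1+p (subst₂ _<_ utp utq (ascent⇒< ut ut-distinct up)) , i<j ,
      covers⇐ us us-distinct i<j (subst₂ _<_ (sym usj) (sym usi) (proj₁ cv)) (trans between-rel (proj₂ cv))
      where cv = covers⇒ u u-distinct i<j cov

    backward : UpDown i j → DownUp i j
    backward (up , i<j , cov') = i<j , covers⇐ u u-distinct i<j (subst₂ _<_ usj usi (proj₁ cv)) (trans (sym between-rel) (proj₂ cv)) ,
      <⇒ascent ut ut-distinct q≡1+p (subst₂ _<_ (sym utp) (sym utq) (ascent⇒< u u-distinct up))
      where cv = covers⇒ us us-distinct i<j cov'

    dCoeff-eq : DownUp i j → dCoeff u i j ≡ dCoeff us i j
    dCoeff-eq _ = dCoeff-cong u us i j i j (sym usi) (sym usj) (sym aCount-rel)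

    matching : Matching i j i j
    matching = forward , backward , dCoeff-eq

  vacuous : ∀ {i j x y : Fin n} → ¬ (toℕ i < toℕ j) → ¬ (toℕ x < toℕ y) → Matching i j x y
  vacuous i≮j x≮y = (λ down-up → ⊥-elim (i≮j (proj₁ down-up))) , (λ up-down → ⊥-elim (x≮y (proj₁ (proj₂ up-down)))) ,
                    (λ down-up → ⊥-elim (i≮j (proj₁ down-up)))

  reindex : ∀ {i j x y : Fin n} → s i ≡ x → s j ≡ y → Matching i j x y → Matching i j (s i) (s j)
  reindex {i} {j} si≡x sj≡y = subst₂ (Matching i j) (sym si≡x) (sym sj≡y)

  private
    irr : ∀ (x : Fin n) → ¬ (toℕ x < toℕ x)
    irr x = NP.<-irrefl refl

    p<⇒q≤ : ∀ {j : Fin n} → toℕ p < toℕ j → toℕ q ≤ toℕ j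
    p<⇒q≤ h = subst (_≤ _) (sym q≡1+p) h

    ≤∧≢⇒< : ∀ {x y : Fin n} → toℕ x ≤ toℕ y → y ≢ x → toℕ x < toℕ y
    ≤∧≢⇒< x≤y y≢x = NP.≤∧≢⇒< x≤y (λ e → y≢x (FP.toℕ-injective (sym e)))

    <q⇒≤p : ∀ {i : Fin n} → toℕ i < toℕ q → toℕ i ≤ toℕ p
    <q⇒≤p h = NP.≤-pred (subst (_ <_) q≡1+p h)

  matching : ∀ i j → ¬ (i ≡ p × j ≡ q) → ¬ (i ≡ q × j ≡ p) → Matching i j (s i) (s j)
  matching i j ≢pq ≢qp = by-cases (i FP.≟ p) (i FP.≟ q) (j FP.≟ p) (j FP.≟ q)
    where
    by-cases : Dec (i ≡ p) → Dec (i ≡ q) → Dec (j ≡ p) → Dec (j ≡ q) → Matching i j (s i) (s j)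
    by-cases (yes refl) _ _ (yes refl) = ⊥-elim (≢pq (refl , refl))
    by-cases _ (yes refl) (yes refl) _ = ⊥-elim (≢qp (refl , refl))
    by-cases (yes refl) _ (yes refl) _ = vacuous (irr p) (irr (s p))
    by-cases _ (yes refl) _ (yes refl) = vacuous (irr q) (irr (s q))
    by-cases (yes refl) _ (no j≢p) (no j≢q) with NP.<-cmp (toℕ q) (toℕ j)
    ... | tri< q<j _ _ = reindex (τ-i p q) (τ-away j≢p j≢q) (From-p.matching j q<j)
    ... | tri≈ _ q≡j _ = ⊥-elim (j≢q (FP.toℕ-injective (sym q≡j)))
    ... | tri> q≮j _ _ = reindex (τ-i p q) (τ-away j≢p j≢q) (vacuous (λ h → q≮j (≤∧≢⇒< (p<⇒q≤ h) j≢q)) q≮j)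
    by-cases (no _) (yes refl) (no j≢p) (no j≢q) with NP.<-cmp (toℕ q) (toℕ j)
    ... | tri< q<j _ _ = reindex (τ-j p q) (τ-away j≢p j≢q) (From-q.matching j q<j)
    ... | tri≈ _ q≡j _ = ⊥-elim (j≢q (FP.toℕ-injective (sym q≡j)))
    ... | tri> q≮j _ _ = reindex (τ-j p q) (τ-away j≢p j≢q) (vacuous q≮j (λ h → q≮j (≤∧≢⇒< (p<⇒q≤ h) j≢q)))
    by-cases (no i≢p) (no i≢q) (yes refl) _ with NP.<-cmp (toℕ i) (toℕ p)
    ... | tri< i<p _ _ = reindex (τ-away i≢p i≢q) (τ-i p q) (To-p.matching i i<p)
    ... | tri≈ _ i≡p _ = ⊥-elim (i≢p (FP.toℕ-injective i≡p))
    ... | tri> i≮p _ _ = reindex (τ-away i≢p i≢q) (τ-i p q) (vacuous i≮p (λ h → i≮p (≤∧≢⇒< (<q⇒≤p h) (≢-sym i≢p))))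
    by-cases (no i≢p) (no i≢q) (no _) (yes refl) with NP.<-cmp (toℕ i) (toℕ p)
    ... | tri< i<p _ _ = reindex (τ-away i≢p i≢q) (τ-j p q) (To-q.matching i i<p)
    ... | tri≈ _ i≡p _ = ⊥-elim (i≢p (FP.toℕ-injective i≡p))
    ... | tri> i≮p _ _ = reindex (τ-away i≢p i≢q) (τ-j p q) (vacuous (λ h → i≮p (≤∧≢⇒< (<q⇒≤p h) (≢-sym i≢p))) i≮p)
    by-cases (no i≢p) (no i≢q) (no j≢p) (no j≢q) =
      reindex (τ-away i≢p i≢q) (τ-away j≢p j≢q) (Away.matching i j i≢p i≢q j≢p j≢q)

swap-swap-conjugate : ∀ {n} (u : Vec ℕ n) (i j p q : Fin n) →
  swap (swap u i j) p q ≡ swap (swap u p q) (τ p q i) (τ p q j)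
swap-swap-conjugate u i j p q = vec-ext _ _ (λ m →
  trans (lookup-swap (swap u i j) p q m) (trans (lookup-swap u i j (s m))
    (sym (trans (lookup-swap (swap u p q) (s i) (s j) m)
                (trans (lookup-swap u p q (τ (s i) (s j) m)) (cong (u !_) (conjugate m)))))))
  where
  s = τ p q
  conjugate : ∀ m → s (τ (s i) (s j) m) ≡ τ i j (s m)
  conjugate m = trans (cong (λ z → s (τ (s i) (s j) z)) (sym (τ-involutive p q m)))
                  (trans (cong s (τ-conjugate s (τ-injective p q) i j (s m))) (τ-involutive p q (τ i j (s m))))

IsPerm⇒Distinct : ∀ {n} (u : Vec ℕ n) → IsPerm u → Distinct u
IsPerm⇒Distinct {n} u u↭1⋯n {k} {l} uk≡ul = unique-lookup u (Unique-resp-↭ (↭⇒↭ₛ (↭-sym u↭1⋯n)) 1⋯n-unique) uk≡ul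
  where
  1⋯n-unique : Unique (map suc (upTo n))
  1⋯n-unique = map⁺ NP.suc-injective (upTo⁺ n)
  unique-lookup : ∀ {n} (v : Vec ℕ n) → Unique (toList v) → Distinct v
  unique-lookup (x ∷ xs) _ {F.zero} {F.zero} _ = refl
  unique-lookup (x ∷ xs) (x∉xs ∷ _) {F.zero} {F.suc l} e = ⊥-elim (VAll.lookup⁺ (VAll.toList⁻ x∉xs) l e)
  unique-lookup (x ∷ xs) (x∉xs ∷ _) {F.suc k} {F.zero} e = ⊥-elim (VAll.lookup⁺ (VAll.toList⁻ x∉xs) k (sym e))
  unique-lookup (x ∷ xs) (_ ∷ xs-unique) {F.suc k} {F.suc l} e = cong F.suc (unique-lookup xs xs-unique e)

-- Coefficients of UD(u) and DU(u)

module ℤSum = Sums ZP.+-*-semiring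
open ℤSum using (when; sumOver; when-no; when-yes; when-zero; when-when; when-⇔; when-*ˡ; when-sum; sumOver-*ˡ)
  renaming (sum to ∑ᶻ)

_≟ᵥ_ : ∀ {n} (v w : Vec ℕ n) → Dec (v ≡ w)
v ≟ᵥ w = ≡-dec _≟_ v w

ascent? : ∀ {n} (x : Vec ℕ n) (p q : Fin n) → Dec (Ascent x p q)
ascent? x p q = (toℕ q ≟ suc (toℕ p)) ×-dec (len (swap x p q) ≟ suc (len x))

covers? : ∀ {n} (x : Vec ℕ n) (i j : Fin n) → Dec (Covers x i j)
covers? x i j = suc (len (swap x i j)) ≟ len x

∑∑ᶻ : ∀ {n} → (Fin n → Fin n → ℤ) → ℤ
∑∑ᶻ f = ∑ᶻ (λ i → ∑ᶻ (λ j → f i j))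

coeff≡sumOver : ∀ {n} (w : Vec ℕ n) (xs : LC n) → coeff w xs ≡ sumOver xs (λ cv → when (proj₂ cv ≟ᵥ w) (proj₁ cv))
coeff≡sumOver w [] = refl
coeff≡sumOver w ((c , v) ∷ xs) with ≡-dec _≟_ v w
... | yes _ = cong (λ z → c ℤ.+ z) (coeff≡sumOver w xs)
... | no _ = trans (coeff≡sumOver w xs) (sym (ZP.+-identityˡ _))

coeff-++ : ∀ {n} (w : Vec ℕ n) (xs ys : LC n) → coeff w (xs ++ ys) ≡ coeff w xs ℤ.+ coeff w ys
coeff-++ w xs ys = trans (coeff≡sumOver w (xs ++ ys)) (trans (ℤSum.sumOver-++ xs ys _)
  (sym (cong₂ ℤ._+_ (coeff≡sumOver w xs) (coeff≡sumOver w ys))))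

coeff-neg : ∀ {n} (w : Vec ℕ n) (xs : LC n) → coeff w (map (λ { (c , v) → (ℤ.- c , v) }) xs) ≡ ℤ.- coeff w xs
coeff-neg w [] = refl
coeff-neg w ((c , v) ∷ xs) with ≡-dec _≟_ v w
... | yes _ = trans (cong (λ z → ℤ.- c ℤ.+ z) (coeff-neg w xs)) (sym (ZP.neg-distrib-+ c (coeff w xs)))
... | no _ = coeff-neg w xs

coeff-lin : ∀ {n} (w : Vec ℕ n) (f : Vec ℕ n → LC n) (xs : LC n) →
  coeff w (lin f xs) ≡ sumOver xs (λ cv → proj₁ cv ℤ.* coeff w (f (proj₂ cv)))
coeff-lin w f xs = trans (coeff≡sumOver w (lin f xs)) (trans (ℤSum.sumOver-concatMap _ xs _)
  (ℤSum.sumOver-cong xs (λ { (c , v) → trans (ℤSum.sumOver-map _ (f v) _)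
     (trans (ℤSum.sumOver-cong (f v) (λ { (d , x) → when-*ˡ (x ≟ᵥ w) c d }))
       (trans (sumOver-*ˡ c (f v) (λ dx → when (proj₂ dx ≟ᵥ w) (proj₁ dx))) (cong (c ℤ.*_) (sym (coeff≡sumOver w (f v)))))) })))

coeff-U : ∀ {n} (w v : Vec ℕ n) → coeff w (U v) ≡
  ∑∑ᶻ (λ p q → when (toℕ p <? toℕ q) (when (ascent? v p q) (when (swap v p q ≟ᵥ w) (+ suc (toℕ p)))))
coeff-U {n} w v = trans (coeff≡sumOver w (U v)) (trans (ℤSum.sumOver-map _ (filter _ (pairs n)) _)
  (trans (ℤSum.sumOver-filter _ (pairs n) _) (ℤSum.sumOver-pairs n _)))

coeff-D : ∀ {n} (w v : Vec ℕ n) → coeff w (D v) ≡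
  ∑∑ᶻ (λ i j → when (toℕ i <? toℕ j) (when (covers? v i j) (when (swap v i j ≟ᵥ w) (dCoeff v i j))))
coeff-D {n} w v = trans (coeff≡sumOver w (D v)) (trans (ℤSum.sumOver-map _ (filter _ (pairs n)) _)
  (trans (ℤSum.sumOver-filter _ (pairs n) _) (ℤSum.sumOver-pairs n _)))

coeff-lin-U : ∀ {n} (w u : Vec ℕ n) → coeff w (lin U (D u)) ≡
  ∑∑ᶻ (λ i j → when (toℕ i <? toℕ j) (when (covers? u i j) (dCoeff u i j ℤ.* coeff w (U (swap u i j)))))
coeff-lin-U {n} w u = trans (coeff-lin w U (D u)) (trans (ℤSum.sumOver-map _ (filter _ (pairs n)) _)
  (trans (ℤSum.sumOver-filter _ (pairs n) _) (ℤSum.sumOver-pairs n _)))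

coeff-lin-D : ∀ {n} (w u : Vec ℕ n) → coeff w (lin D (U u)) ≡
  ∑∑ᶻ (λ p q → when (toℕ p <? toℕ q) (when (ascent? u p q) (+ suc (toℕ p) ℤ.* coeff w (D (swap u p q)))))
coeff-lin-D {n} w u = trans (coeff-lin w D (U u)) (trans (ℤSum.sumOver-map _ (filter _ (pairs n)) _)
  (trans (ℤSum.sumOver-filter _ (pairs n) _) (ℤSum.sumOver-pairs n _)))

∑∑ᶻ-interchange : ∀ {n} (F : Fin n → Fin n → Fin n → Fin n → ℤ) →
  ∑∑ᶻ (λ i j → ∑∑ᶻ (λ p q → F i j p q)) ≡ ∑∑ᶻ (λ p q → ∑∑ᶻ (λ i j → F i j p q))
∑∑ᶻ-interchange F =
  trans (ℤSum.sum-cong-≗ (λ i → ℤSum.∑-comm (λ j p → ∑ᶻ (λ q → F i j p q))))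
  (trans (ℤSum.sum-cong-≗ (λ i → ℤSum.sum-cong-≗ (λ p → ℤSum.∑-comm (λ j q → F i j p q))))
  (trans (ℤSum.∑-comm (λ i p → ∑ᶻ (λ q → ∑ᶻ (λ j → F i j p q))))
  (ℤSum.sum-cong-≗ (λ p → ℤSum.∑-comm (λ i q → ∑ᶻ (λ j → F i j p q))))))

when²-*-∑∑ᶻ : ∀ {a b} {P : Set a} {Q : Set b} (d : Dec P) (e : Dec Q) c {n} (f : Fin n → Fin n → ℤ) →
  when d (when e (c ℤ.* ∑∑ᶻ f)) ≡ ∑∑ᶻ (λ p q → when d (when e (c ℤ.* f p q)))
when²-*-∑∑ᶻ d e c f =
  trans (cong (λ z → when d (when e z)) (ℤSum.*-distribˡ-sum c (λ p → ∑ᶻ (f p))))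
  (trans (cong (when d) (when-sum e (λ p → c ℤ.* ∑ᶻ (f p))))
  (trans (when-sum d (λ p → when e (c ℤ.* ∑ᶻ (f p))))
  (ℤSum.sum-cong-≗ (λ p → trans (cong (λ z → when d (when e z)) (ℤSum.*-distribˡ-sum c (f p)))
     (trans (cong (when d) (when-sum e (λ q → c ℤ.* f p q))) (when-sum d (λ q → when e (c ℤ.* f p q))))))))

module _ {n} (u w : Vec ℕ n) (u-distinct : Distinct u) (u≢w : u ≢ w) where

  udTerm : Fin n → Fin n → Fin n → Fin n → ℤ
  udTerm i j p q = when (toℕ i <? toℕ j) (when (covers? u i j) (dCoeff u i j ℤ.* when (toℕ p <? toℕ q)
    (when (ascent? (swap u i j) p q) (when (swap (swap u i j) p q ≟ᵥ w) (+ suc (toℕ p))))))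

  duTerm : Fin n → Fin n → Fin n → Fin n → ℤ
  duTerm p q i j = when (toℕ p <? toℕ q) (when (ascent? u p q) (+ suc (toℕ p) ℤ.* when (toℕ i <? toℕ j)
    (when (covers? (swap u p q) i j) (when (swap (swap u p q) i j ≟ᵥ w) (dCoeff (swap u p q) i j)))))

  coeff-UD : coeff w (lin U (D u)) ≡ ∑∑ᶻ (λ i j → ∑∑ᶻ (λ p q → udTerm i j p q))
  coeff-UD = trans (coeff-lin-U w u) (ℤSum.sum-cong-≗ (λ i → ℤSum.sum-cong-≗ (λ j →
    trans (cong (λ z → when (toℕ i <? toℕ j) (when (covers? u i j) (dCoeff u i j ℤ.* z))) (coeff-U w (swap u i j)))
          (when²-*-∑∑ᶻ (toℕ i <? toℕ j) (covers? u i j) (dCoeff u i j) (λ p q → when (toℕ p <? toℕ q)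
            (when (ascent? (swap u i j) p q) (when (swap (swap u i j) p q ≟ᵥ w) (+ suc (toℕ p)))))))))

  coeff-DU : coeff w (lin D (U u)) ≡ ∑∑ᶻ (λ p q → ∑∑ᶻ (λ i j → duTerm p q i j))
  coeff-DU = trans (coeff-lin-D w u) (ℤSum.sum-cong-≗ (λ p → ℤSum.sum-cong-≗ (λ q →
    trans (cong (λ z → when (toℕ p <? toℕ q) (when (ascent? u p q) (+ suc (toℕ p) ℤ.* z))) (coeff-D w (swap u p q)))
          (when²-*-∑∑ᶻ (toℕ p <? toℕ q) (ascent? u p q) (+ suc (toℕ p)) (λ i j → when (toℕ i <? toℕ j)
            (when (covers? (swap u p q) i j) (when (swap (swap u p q) i j ≟ᵥ w) (dCoeff (swap u p q) i j))))))))

  terms-nonadjacent : ∀ p q → toℕ q ≢ suc (toℕ p) → ∑∑ᶻ (λ i j → udTerm i j p q) ≡ ∑∑ᶻ (λ i j → duTerm p q i j)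
  terms-nonadjacent p q q≢1+p = ℤSum.sum-cong-≗ (λ i → ℤSum.sum-cong-≗ (λ j → trans (ud≡0 i j) (sym (du≡0 i j))))
    where
    du≡0 : ∀ i j → duTerm p q i j ≡ + 0
    du≡0 i j = trans (cong (when (toℕ p <? toℕ q)) (when-no (ascent? u p q) (q≢1+p ∘ proj₁) _)) (when-zero (toℕ p <? toℕ q))
    ud≡0 : ∀ i j → udTerm i j p q ≡ + 0
    ud≡0 i j = begin
      udTerm i j p q
        ≡⟨ cong (λ z → when (toℕ i <? toℕ j) (when (covers? u i j) (dCoeff u i j ℤ.* when (toℕ p <? toℕ q) z)))
                (when-no (ascent? (swap u i j) p q) (q≢1+p ∘ proj₁) _) ⟩
      when (toℕ i <? toℕ j) (when (covers? u i j) (dCoeff u i j ℤ.* when (toℕ p <? toℕ q) (+ 0)))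
        ≡⟨ cong (λ z → when (toℕ i <? toℕ j) (when (covers? u i j) (dCoeff u i j ℤ.* z))) (when-zero (toℕ p <? toℕ q)) ⟩
      when (toℕ i <? toℕ j) (when (covers? u i j) (dCoeff u i j ℤ.* + 0))
        ≡⟨ cong (λ z → when (toℕ i <? toℕ j) (when (covers? u i j) z)) (ZP.*-zeroʳ (dCoeff u i j)) ⟩
      when (toℕ i <? toℕ j) (when (covers? u i j) (+ 0))
        ≡⟨ trans (cong (when (toℕ i <? toℕ j)) (when-zero (covers? u i j))) (when-zero (toℕ i <? toℕ j)) ⟩
      + 0 ∎
      where open ≡-Reasoning

  module Adjacent (p q : Fin n) (q≡1+p : toℕ q ≡ suc (toℕ p)) where
    open AdjacentTransposition u u-distinct p q q≡1+p

    swap-pq-pq≢w : swap (swap u p q) p q ≢ w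
    swap-pq-pq≢w e = u≢w (trans (sym (vec-ext _ _ (lookup-swap-swap u p q))) e)

    swap-qp-pq≢w : swap (swap u q p) p q ≢ w
    swap-qp-pq≢w e = u≢w (trans (vec-ext _ _ u≡swap-qp-pq) e)
      where
      u≡swap-qp-pq : ∀ m → u ! m ≡ swap (swap u q p) p q ! m
      u≡swap-qp-pq m = sym (trans (lookup-swap (swap u q p) p q m) (trans (lookup-swap u q p (s m))
                         (cong (u !_) (trans (τ-sym p q (s m)) (τ-involutive p q m)))))

    matching-or-absent : ∀ i j → (swap (swap u i j) p q ≢ w) ⊎ Matching i j (s i) (s j)
    matching-or-absent i j = by-cases (i FP.≟ p) (j FP.≟ q) (i FP.≟ q) (j FP.≟ p)
      where
      by-cases : Dec (i ≡ p) → Dec (j ≡ q) → Dec (i ≡ q) → Dec (j ≡ p) →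
                 (swap (swap u i j) p q ≢ w) ⊎ Matching i j (s i) (s j)
      by-cases (yes refl) (yes refl) _ _ = inj₁ swap-pq-pq≢w
      by-cases _ _ (yes refl) (yes refl) = inj₁ swap-qp-pq≢w
      by-cases (no i≢p) _ (no i≢q) _ = inj₂ (matching i j (i≢p ∘ proj₁) (i≢q ∘ proj₁))
      by-cases (no i≢p) _ (yes _) (no j≢p) = inj₂ (matching i j (i≢p ∘ proj₁) (j≢p ∘ proj₂))
      by-cases (yes _) (no j≢q) (no i≢q) _ = inj₂ (matching i j (j≢q ∘ proj₂) (i≢q ∘ proj₁))
      by-cases (yes i≡p) (no _) (yes i≡q) _ = ⊥-elim (p≢q (trans (sym i≡p) i≡q))

    terms-match : ∀ i j → udTerm i j p q ≡ duTerm p q (s i) (s j)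
    terms-match i j = begin
      udTerm i j p q
        ≡⟨ cong (λ z → when d₁ (when d₂ z)) (trans (cong (dC ℤ.*_) (when-yes (toℕ p <? toℕ q) p<q _))
             (trans (sym (when-*ˡ d₃ dC (when d₄ k))) (cong (when d₃) (sym (when-*ˡ d₄ dC k))))) ⟩
      when d₁ (when d₂ (when d₃ (when d₄ (dC ℤ.* k))))     ≡⟨ when⁴ d₁ d₂ d₃ d₄ _ ⟩
      when (d₁ ×-dec d₂ ×-dec d₃ ×-dec d₄) (dC ℤ.* k)       ≡⟨ chains-match ⟩
      when (e₁ ×-dec e₂ ×-dec e₃ ×-dec e₄) (k ℤ.* dC′)      ≡⟨ sym (when⁴ e₁ e₂ e₃ e₄ _) ⟩
      when e₁ (when e₂ (when e₃ (when e₄ (k ℤ.* dC′))))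
        ≡⟨ sym (trans (when-yes (toℕ p <? toℕ q) p<q _) (cong (when e₁)
             (trans (sym (when-*ˡ e₂ k _)) (cong (when e₂) (trans (sym (when-*ˡ e₃ k _)) (cong (when e₃) (sym (when-*ˡ e₄ k dC′)))))))) ⟩
      duTerm p q (s i) (s j) ∎
      where
      open ≡-Reasoning
      k = + suc (toℕ p)
      dC = dCoeff u i j
      dC′ = dCoeff us (s i) (s j)
      d₁ = toℕ i <? toℕ j
      d₂ = covers? u i j
      d₃ = ascent? (swap u i j) p q
      d₄ = swap (swap u i j) p q ≟ᵥ w
      e₁ = ascent? u p q
      e₂ = toℕ (s i) <? toℕ (s j)
      e₃ = covers? us (s i) (s j)
      e₄ = swap us (s i) (s j) ≟ᵥ w
      when⁴ : ∀ {a b c d} {A : Set a} {B : Set b} {C : Set c} {D : Set d}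
              (x₁ : Dec A) (x₂ : Dec B) (x₃ : Dec C) (x₄ : Dec D) z →
              when x₁ (when x₂ (when x₃ (when x₄ z))) ≡ when (x₁ ×-dec x₂ ×-dec x₃ ×-dec x₄) z
      when⁴ x₁ x₂ x₃ x₄ z = trans (cong (when x₁) (trans (cong (when x₂) (when-when x₃ x₄ z)) (when-when x₂ (x₃ ×-dec x₄) z)))
                                  (when-when x₁ (x₂ ×-dec x₃ ×-dec x₄) z)
      conjugate = swap-swap-conjugate u i j p q
      chains-match : when (d₁ ×-dec d₂ ×-dec d₃ ×-dec d₄) (dC ℤ.* k) ≡ when (e₁ ×-dec e₂ ×-dec e₃ ×-dec e₄) (k ℤ.* dC′)
      chains-match with matching-or-absent i j
      ... | inj₁ absent = when-⇔ (d₁ ×-dec d₂ ×-dec d₃ ×-dec d₄) (e₁ ×-dec e₂ ×-dec e₃ ×-dec e₄)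
                                     (λ t → ⊥-elim (absent (proj₂ (proj₂ (proj₂ t)))))
                                     (λ t → ⊥-elim (absent (trans conjugate (proj₂ (proj₂ (proj₂ t))))))
                                     (λ t → ⊥-elim (absent (proj₂ (proj₂ (proj₂ t)))))
      ... | inj₂ (forward , backward , dCoeff-eq) = when-⇔ (d₁ ×-dec d₂ ×-dec d₃ ×-dec d₄) (e₁ ×-dec e₂ ×-dec e₃ ×-dec e₄)
            (λ { (i<j , covers , ascent , hits-w) → let (x₁ , x₂ , x₃) = forward (i<j , covers , ascent)
                                                     in x₁ , x₂ , x₃ , trans (sym conjugate) hits-w })
            (λ { (ascent , si<sj , covers , hits-w) → let (x₁ , x₂ , x₃) = backward (ascent , si<sj , covers)
                                                       in x₁ , x₂ , x₃ , trans conjugate hits-w })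
            (λ { (i<j , covers , ascent , _) → trans (cong (ℤ._* k) (dCoeff-eq (i<j , covers , ascent))) (ZP.*-comm dC′ k) })

    terms-adjacent : ∑∑ᶻ (λ i j → udTerm i j p q) ≡ ∑∑ᶻ (λ i j → duTerm p q i j)
    terms-adjacent = sym (trans (ℤSum.sum-transpose p q (λ i → ∑ᶻ (λ j → duTerm p q i j)))
      (trans (ℤSum.sum-cong-≗ (λ i → ℤSum.sum-transpose p q (λ j → duTerm p q (s i) j)))
        (ℤSum.sum-cong-≗ (λ i → ℤSum.sum-cong-≗ (λ j → sym (terms-match i j))))))

  terms : ∀ p q → ∑∑ᶻ (λ i j → udTerm i j p q) ≡ ∑∑ᶻ (λ i j → duTerm p q i j)
  terms p q with toℕ q ℕ.≟ suc (toℕ p)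
  ... | yes q≡1+p = Adjacent.terms-adjacent p q q≡1+p
  ... | no q≢1+p = terms-nonadjacent p q q≢1+p

  coeff-comm≡0 : coeff w (comm u) ≡ + 0
  coeff-comm≡0 = begin
    coeff w (comm u)                                   ≡⟨ coeff-++ w (lin U (D u)) _ ⟩
    coeff w (lin U (D u)) ℤ.+ coeff w (map _ (lin D (U u)))  ≡⟨ cong (λ z → coeff w (lin U (D u)) ℤ.+ z) (coeff-neg w (lin D (U u))) ⟩
    coeff w (lin U (D u)) ℤ.- coeff w (lin D (U u))    ≡⟨ cong₂ ℤ._-_ (trans coeff-UD (∑∑ᶻ-interchange udTerm)) coeff-DU ⟩
    ∑∑ᶻ (λ p q → ∑∑ᶻ (λ i j → udTerm i j p q)) ℤ.- ∑∑ᶻ (λ p q → ∑∑ᶻ (λ i j → duTerm p q i j))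
      ≡⟨ cong (λ z → z ℤ.- ∑∑ᶻ (λ p q → ∑∑ᶻ (λ i j → duTerm p q i j)))
              (ℤSum.sum-cong-≗ (λ p → ℤSum.sum-cong-≗ (λ q → terms p q))) ⟩
    ∑∑ᶻ (λ p q → ∑∑ᶻ (λ i j → duTerm p q i j)) ℤ.- ∑∑ᶻ (λ p q → ∑∑ᶻ (λ i j → duTerm p q i j))
      ≡⟨ ZP.+-inverseʳ (∑∑ᶻ (λ p q → ∑∑ᶻ (λ i j → duTerm p q i j))) ⟩
    + 0 ∎
    where open ≡-Reasoning

-- Only the distinctness of the entries of u is used.
lemma2p2 : (n : ℕ) → 1 ≤ n → (u w : Vec ℕ n) → IsPerm u → IsPerm w → u ≢ w →
    coeff w (comm u) ≡ + 0
lemma2p2 n _ u w u-perm _ u≢w = coeff-comm≡0 u w (IsPerm⇒Distinct u u-perm) u≢w
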